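{- Let $U=(U_{ij})_{i,j\in I}$ be a nonsingular $\mathcal U$-matrix with supporting dyadic tree $(T,\mathcal J)$, root $r$ (identified with $I$) and distinguished leaf $n$. Then: (i) $\mathcal R^t_I=\{n\}$. (ii) For every vertex $L\in T$ and every leaf $i\in L$: $i\in\mathcal R^t_L$ if and only if $\mathrm{geod}(i,L)\cap\Gamma^t=\emptyset$ (where $\mathrm{geod}(i,L)$ is regarded as a set of edges).
   Context: Trees. $(T,\mathcal J)$ is a finite tree with a distinguished root $r$; $\mathrm{geod}(s,t)$ is the unique shortest path between vertices $s,t$ (also regarded as its set of edges). Write $s\preceq t$ if $s$ lies on $\mathrm{geod}(t,r)$ (so $r$ is the least element). $s\wedge t$ is the $\preceq$-largest vertex lying on both $\mathrm{geod}(s,r)$ and $\mathrm{geod}(t,r)$. The successors of $t$ are its neighbours $s\ne t$ with $t\preceq s$; leaves are vertices without successors and their set is $I$. The tree is dyadic if every non-leaf $t$ has exactly two successors, denoted $t^-$ and $t^+$. Each vertex $t$ is identified with the set of leaves $i$ with $t\preceq i$ (so $r$ is identified with $I$, a leaf $i$ with $\{i\}$, and "$i\in L$" for a vertex $L$ means $i$ is a leaf below $L$). Edges are written $(L,L^-)$ and $(L,L^+)$. $\mathcal U$-matrices. A real matrix $U=(U_{ij})_{i,j\in I}$ is a $\mathcal U$-matrix if there exist a dyadic tree with root $r$ and leaf set $I$, a distinguished leaf $n$, and nonnegative vectors $(\alpha_t)_{t\in T},(\beta_t)_{t\in T}$ such that: (i) $\alpha_i=\beta_i$ for every leaf $i$,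 and $\alpha_t=\alpha_{t\wedge n}$ for every non-leaf $t$ with $r^+\preceq t$; (ii) $\alpha_t\le\beta_t$ for all $t$; (iii) $t\preceq s$ implies $\alpha_t\le\alpha_s$ and $\beta_t\le\beta_s$; (iv) for every non-leaf $t$ on $\mathrm{geod}(r,n)$, $t^+$ lies on $\mathrm{geod}(r,n)$, and $\alpha_t=\beta_t$ for all $t$ on $\mathrm{geod}(r,n)$; (v) $U_{ii}=\alpha_i$, and for $i\neq j$ with $t=i\wedge j$: $U_{ij}=\alpha_t$ if $i\in t^-,j\in t^+$, while $U_{ij}=\beta_s$ if $i\in t^+,j\in t^-$, where $s$ is the $\preceq$-larger of $i\wedge j$ and $i\wedge n$. The leaves are labelled $I=\{1,\dots,n\}$ so that $i<j$ iff $i\in(i\wedge j)^-$ and $j\in(i\wedge j)^+$; the distinguished leaf is the label $n$. Potentials and exiting roots. For a vertex $L$ let $U_L=U|_{L\times L}$ (nonsingular whenever $U$ is). Put $\nu_L=(U_L^t)^{ -1}\mathbf 1$ and $\mathcal R^t_L=\{i\in L:(\nu_L)_i>0\}$ (exiting roots of the transposed sub-Markov kernel). The set $\Gamma^t$ of edges. For a leaf $i$ let $N_i^+=\{L\in T: L\preceq i,\ \alpha_L=\alpha_i\}$ and $N_i^-=\{L\in T:L\preceq i,\ \beta_L=\beta_i\}$. For a non-leaf $L$ not on $\mathrm{geod}(r,n)$: $(L,L^-)\in\Gamma^t$ iff there is $i\in L^+$ with $L\in N_i^-$; $(L,L^+)\in\Gamma^t$ iff there is $i\in L^-$ with $L\in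 N_i^+$. For a non-leaf $L$ on $\mathrm{geod}(r,n)$: $(L,L^-)\in\Gamma^t$ and $(L,L^+)\notin\Gamma^t$. -}

module Defs where

open import Data.List using (List; []; _∷_; _++_; map; foldr)
open import Data.Product using (Σ; ∃; _×_; _,_)
open import Data.Sum using (_⊎_)
open import Data.Nat using (ℕ; zero; suc; _<ᵇ_)
open import Data.Bool using (if_then_else_)
open import Relation.Binary.PropositionalEquality using (_≡_; _≢_)
open import Relation.Nullary using (¬_)
open import Algebra.Structures using (IsCommutativeRing)
open import Relation.Binary.Structures using (IsStrictTotalOrder)

record RealField : Set₁ where
  infixl 6 _+_
  infixl 7 _*_
  infix 4 _<_
  field
    ℝ : Set
    _+_ _*_ : ℝ → ℝ → ℝ
    -_ : ℝ → ℝ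
    0r 1r : ℝ
    _<_ : ℝ → ℝ → Set
    isCommutativeRing : IsCommutativeRing _≡_ _+_ _*_ -_ 0r 1r
    0≢1 : 0r ≢ 1r
    inverse : ∀ x → x ≢ 0r → ∃ λ y → x * y ≡ 1r
    isStrictTotalOrder : IsStrictTotalOrder _≡_ _<_
    +-mono-< : ∀ {x y} z → x < y → x + z < y + z
    *-pos : ∀ {x y} → 0r < x → 0r < y → 0r < x * y
    complete : (P : ℝ → Set) → ∃ P →
               (∃ λ b → ∀ x → P x → (x < b ⊎ x ≡ b)) →
               ∃ λ s → (∀ x → P x → (x < s ⊎ x ≡ s)) ×
                       (∀ b → (∀ x → P x → (x < b ⊎ x ≡ b)) → (s < b ⊎ s ≡ b))

  infix 4 _≤_
  _≤_ : ℝ → ℝ → Set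
  x ≤ y = x < y ⊎ x ≡ y

-- Finite rooted dyadic trees.  A vertex is a position in the tree;
-- goL / goR descend to the successor t⁻ / t⁺.

data Tree : Set where
  leaf : Tree
  node : Tree → Tree → Tree

data Pos : Tree → Set where
  here : ∀ {t} → Pos t
  goL  : ∀ {l r} → Pos l → Pos (node l r)
  goR  : ∀ {l r} → Pos r → Pos (node l r)

sub : ∀ {t} → Pos t → Tree
sub {t} here = t
sub (goL p) = sub p
sub (goR p) = sub p

IsLeaf : ∀ {t} → Pos t → Set
IsLeaf p = sub p ≡ leaf

-- s ⪯ t : s lies on geod(t, r)
infix 4 _⪯_
data _⪯_ : ∀ {t} → Pos t → Pos t → Set where
  ⪯-here : ∀ {t} {q : Pos t} → here ⪯ q
  ⪯-L    : ∀ {l r} {p q : Pos l} → p ⪯ q → goL {l} {r} p ⪯ goL q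
  ⪯-R    : ∀ {l r} {p q : Pos r} → p ⪯ q → goR {l} {r} p ⪯ goR q

meet : ∀ {t} → Pos t → Pos t → Pos t
meet here q = here
meet (goL p) here = here
meet (goR p) here = here
meet (goL p) (goL q) = goL (meet p q)
meet (goL p) (goR q) = here
meet (goR p) (goL q) = here
meet (goR p) (goR q) = goR (meet p q)

-- the distinguished leaf n: the last leaf in the left-to-right labelling
-- (i < j iff i ∈ (i∧j)⁻ and j ∈ (i∧j)⁺)
last : (t : Tree) → Pos t
last leaf = here
last (node l r) = goR (last r)

depth : ∀ {t} → Pos t → ℕ
depth here = zero
depth (goL p) = suc (depth p)
depth (goR p) = suc (depth p)

deeper : ∀ {t} → Pos t → Pos t → Pos t
deeper p q = if depth p <ᵇ depth q then q else p

data Cmp : Set where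
  eq lt gt anc desc : Cmp

-- lt : i ∈ (i∧j)⁻, j ∈ (i∧j)⁺ ;  gt : i ∈ (i∧j)⁺, j ∈ (i∧j)⁻
cmp : ∀ {t} → Pos t → Pos t → Cmp
cmp here here = eq
cmp here (goL q) = anc
cmp here (goR q) = anc
cmp (goL p) here = desc
cmp (goR p) here = desc
cmp (goL p) (goL q) = cmp p q
cmp (goL p) (goR q) = lt
cmp (goR p) (goL q) = gt
cmp (goR p) (goR q) = cmp p q

leaves : (t : Tree) → List (Pos t)
leaves leaf = here ∷ []
leaves (node l r) = map goL (leaves l) ++ map goR (leaves r)

extend : ∀ {t} (p : Pos t) → Pos (sub p) → Pos t
extend here q = q
extend (goL p) q = goL (extend p q)
extend (goR p) q = goR (extend p q)

-- the leaves i ∈ L (i.e. L ⪯ i), as a list of vertices of the whole tree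
leavesUnder : ∀ {t} (L : Pos t) → List (Pos t)
leavesUnder L = map (extend L) (leaves (sub L))

-- (L, c) is the edge from L to its successor c, on side s
data Side : Set where
  minus plus : Side

data ChildOf : ∀ {t} → Pos t → Pos t → Side → Set where
  ch-L  : ∀ {l r} → ChildOf {node l r} here (goL here) minus
  ch-R  : ∀ {l r} → ChildOf {node l r} here (goR here) plus
  ch-inL : ∀ {l r} {p c : Pos l} {s} → ChildOf p c s → ChildOf (goL {l} {r} p) (goL c) s
  ch-inR : ∀ {l r} {p c : Pos r} {s} → ChildOf p c s → ChildOf (goR {l} {r} p) (goR c) s

data RightBranch : ∀ {t} → Pos t → Set where
  rb : ∀ {l r} {p : Pos r} → RightBranch (goR {l} {r} p)

module _ (F : RealField) where
  open RealField F

  sumL : ∀ {A : Set} → (A → ℝ) → List A → ℝ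
  sumL f xs = foldr (λ x acc → f x + acc) 0r xs

  -- the 𝒰-matrix built from (T, n = last T, α, β) by rule (v);
  -- entries are only meaningful for leaves i, j (last clause unreachable)
  Umat : (T : Tree) (α β : Pos T → ℝ) → Pos T → Pos T → ℝ
  Umat T α β i j with cmp i j
  ... | eq   = α i
  ... | lt   = α (meet i j)
  ... | gt   = β (deeper (meet i j) (meet i (last T)))
  ... | anc  = 0r
  ... | desc = 0r

  record IsUData (T : Tree) (α β : Pos T → ℝ) : Set where
    field
      α-nonneg  : ∀ t → 0r ≤ α t
      β-nonneg  : ∀ t → 0r ≤ β t
      leaf-eq   : ∀ i → IsLeaf i → α i ≡ β i
      right-α   : ∀ t → RightBranch t → ¬ IsLeaf t → α t ≡ α (meet t (last T))
      α≤β       : ∀ t → α t ≤ β t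
      α-mono    : ∀ t s → t ⪯ s → α t ≤ α s
      β-mono    : ∀ t s → t ⪯ s → β t ≤ β s
      spine-eq  : ∀ t → t ⪯ last T → α t ≡ β t

  Nonsingular : (T : Tree) → (Pos T → Pos T → ℝ) → Set
  Nonsingular T U = ∀ (x : Pos T → ℝ) →
    (∀ i → IsLeaf i → sumL (λ j → U i j * x j) (leaves T) ≡ 0r) →
    ∀ j → IsLeaf j → x j ≡ 0r

  -- ν is ν_L = (U_Lᵗ)⁻¹ 1, i.e. the solution of U_Lᵗ ν = 1 on the leaves of L
  -- (values of ν off the leaves of L are irrelevant)
  IsPotentialᵗ : (T : Tree) → (Pos T → Pos T → ℝ) → Pos T → (Pos T → ℝ) → Set
  IsPotentialᵗ T U L ν = ∀ j → IsLeaf j → L ⪯ j →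
    sumL (λ i → U i j * ν i) (leavesUnder L) ≡ 1r

  -- i ∈ ℛᵗ_L, given ν = ν_L
  ExitingRootᵗ : ∀ {T : Tree} → (Pos T → ℝ) → Pos T → Set
  ExitingRootᵗ ν i = 0r < ν i

  InΓᵗ : (T : Tree) (α β : Pos T → ℝ) → Pos T → Side → Set
  InΓᵗ T α β L minus =
    L ⪯ last T ⊎
    (¬ (L ⪯ last T) × ∃ λ i → IsLeaf i × (∃ λ c → ChildOf L c plus × c ⪯ i)
                              × β L ≡ β i)
  InΓᵗ T α β L plus =
    ¬ (L ⪯ last T) × ∃ λ i → IsLeaf i × (∃ λ c → ChildOf L c minus × c ⪯ i)
                              × α L ≡ α i

  GeodAvoidsΓᵗ : (T : Tree) (α β : Pos T → ℝ) → Pos T → Pos T → Set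
  GeodAvoidsΓᵗ T α β i L = ∀ p c s → ChildOf p c s → L ⪯ p → c ⪯ i → ¬ InΓᵗ T α β p s

-- Split the tree at its root.  Off geod(r, n) the transposed matrix has the block form
-- [[U₁ᵗ, β 1], [α 1, U₂ᵗ]] with constant off-diagonal blocks, so its potential is (k₁ ν₁, k₂ ν₂) where
-- ν₁, ν₂ are the potentials of the two subtrees, A, B their total masses, k₁ = (1 - βB)/D,
-- k₂ = (1 - αA)/D and D = 1 - αA βB.  By induction αA ≤ 1 and βB ≤ 1, and βB = 1 exactly when some
-- leaf of r⁺ has β-value β, i.e. when (r, r⁻) ∈ Γᵗ (likewise αA = 1 iff (r, r⁺) ∈ Γᵗ).  Nonsingularity
-- excludes such ties on both sides at once (they would produce two equal columns), so D > 0 and ν_i > 0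
-- iff no edge of geod(i, r) lies in Γᵗ.  On geod(r, n) the lower-left block repeats the column of n,
-- which forces the potential to vanish on r⁻; hence ℛᵗ_I = {n}.  A vertex L inherits the same structure,
-- which gives (ii) for every L.

module Submission where

open import Defs
open import Algebra.Bundles using (CommutativeRing)
open import Data.Nat as ℕ using (ℕ; zero; suc; _<ᵇ_)
open import Data.Integer as ℤ using (ℤ; 1ℤ)
import Data.Integer.Properties as ℤ
import Data.Nat.Properties as ℕ
open import Data.Sign as Sign using (Sign)
open import Relation.Binary.PropositionalEquality as ≡ using (_≡_; _≢_; subst; subst₂; cong; cong₂)
open import Data.Maybe using (Maybe; just; nothing)
open import Data.Sum using (_⊎_; inj₁; inj₂; [_,_]′)
open import Data.Product using (_×_; _,_; proj₁; proj₂; ∃)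
open import Data.Empty using (⊥; ⊥-elim)
open import Relation.Nullary using (¬_; yes; no)
open import Relation.Binary.Definitions using (tri<; tri≈; tri>)
open import Data.Bool using (Bool; true; false)
open import Function using (_∘_)
open import Data.List using (List; []; _∷_; _++_; map)

-- The ring solver normalises with closed coefficients, here integers mapped into R.
module IntegerCoefficients {c ℓ} (R : CommutativeRing c ℓ) where
  open CommutativeRing R
  open import Algebra.Properties.Ring ring using (-‿distribˡ-*; -‿distribʳ-*; -0#≈0#; -‿involutive; -‿+-comm)
  open import Algebra.Properties.Monoid.Mult.TCOptimised +-monoid using (×-homo-+; 1+×) renaming (_×_ to _·_)
  open import Algebra.Properties.Semiring.Mult.TCOptimised semiring using (×1-homo-*)
  open import Algebra.Solver.Ring.AlmostCommutativeRing using (fromCommutativeRing; _-Raw-AlmostCommutative⟶_)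
  open import Relation.Binary.Reasoning.Setoid setoid

  private
    ⟦_⟧ : ℤ → Carrier
    ⟦ ℤ.+ n ⟧ = n · 1#
    ⟦ ℤ.-[1+ n ] ⟧ = - (suc n · 1#)

    [1+x]-[1+y]≈x-y : ∀ x y → (1# + x) - (1# + y) ≈ x - y
    [1+x]-[1+y]≈x-y x y = begin
      (1# + x) + - (1# + y)   ≈⟨ +-congˡ (sym (-‿+-comm 1# y)) ⟩
      (1# + x) + (- 1# + - y) ≈⟨ +-congʳ (+-comm 1# x) ⟩
      (x + 1#) + (- 1# + - y) ≈⟨ +-assoc x 1# _ ⟩
      x + (1# + (- 1# + - y)) ≈⟨ +-congˡ (sym (+-assoc 1# (- 1#) (- y))) ⟩
      x + ((1# + - 1#) + - y) ≈⟨ +-congˡ (+-congʳ (-‿inverseʳ 1#)) ⟩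
      x + (0# + - y)          ≈⟨ +-congˡ (+-identityˡ (- y)) ⟩
      x - y                   ∎

    ⊖-homo : ∀ m n → ⟦ m ℤ.⊖ n ⟧ ≈ m · 1# - n · 1#
    ⊖-homo zero zero = sym (-‿inverseʳ 0#)
    ⊖-homo zero (suc n) = sym (+-identityˡ _)
    ⊖-homo (suc m) zero = sym (trans (+-congˡ -0#≈0#) (+-identityʳ _))
    ⊖-homo (suc m) (suc n) = begin
      ⟦ suc m ℤ.⊖ suc n ⟧             ≡⟨ cong ⟦_⟧ (ℤ.[1+m]⊖[1+n]≡m⊖n m n) ⟩
      ⟦ m ℤ.⊖ n ⟧                     ≈⟨ ⊖-homo m n ⟩
      m · 1# - n · 1#                 ≈⟨ sym ([1+x]-[1+y]≈x-y _ _) ⟩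
      (1# + m · 1#) - (1# + n · 1#)   ≈⟨ sym (+-cong (1+× m 1#) (-‿cong (1+× n 1#))) ⟩
      suc m · 1# - suc n · 1#         ∎

    +-homo : ∀ i j → ⟦ i ℤ.+ j ⟧ ≈ ⟦ i ⟧ + ⟦ j ⟧
    +-homo ℤ.-[1+ m ] ℤ.-[1+ n ] = begin
      - (suc (suc (m ℕ.+ n)) · 1#)        ≡⟨ cong (λ k → - (suc k · 1#)) (≡.sym (ℕ.+-suc m n)) ⟩
      - ((suc m ℕ.+ suc n) · 1#)          ≈⟨ -‿cong (×-homo-+ 1# (suc m) (suc n)) ⟩
      - (suc m · 1# + suc n · 1#)         ≈⟨ sym (-‿+-comm _ _) ⟩
      - (suc m · 1#) + - (suc n · 1#)     ∎
    +-homo ℤ.-[1+ m ] (ℤ.+ n) = trans (⊖-homo n (suc m)) (+-comm _ _)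
    +-homo (ℤ.+ m) ℤ.-[1+ n ] = ⊖-homo m (suc n)
    +-homo (ℤ.+ m) (ℤ.+ n) = ×-homo-+ 1# m n

    -‿homo : ∀ i → ⟦ ℤ.- i ⟧ ≈ - ⟦ i ⟧
    -‿homo ℤ.-[1+ n ] = sym (-‿involutive _)
    -‿homo (ℤ.+ zero) = sym -0#≈0#
    -‿homo (ℤ.+ suc n) = refl

    signed : Sign → Carrier → Carrier
    signed Sign.+ x = x
    signed Sign.- x = - x

    ◃-homo : ∀ s n → ⟦ s ℤ.◃ n ⟧ ≈ signed s (n · 1#)
    ◃-homo Sign.+ zero = refl
    ◃-homo Sign.- zero = sym -0#≈0#
    ◃-homo Sign.+ (suc n) = refl
    ◃-homo Sign.- (suc n) = refl

    signed-abs : ∀ i → ⟦ i ⟧ ≈ signed (ℤ.sign i) (ℤ.∣ i ∣ · 1#)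
    signed-abs (ℤ.+ n) = refl
    signed-abs ℤ.-[1+ n ] = refl

    signed-* : ∀ s t x y → signed (s Sign.* t) (x * y) ≈ signed s x * signed t y
    signed-* Sign.+ Sign.+ x y = refl
    signed-* Sign.+ Sign.- x y = -‿distribʳ-* x y
    signed-* Sign.- Sign.+ x y = -‿distribˡ-* x y
    signed-* Sign.- Sign.- x y = begin
      x * y         ≈⟨ sym (-‿involutive _) ⟩
      - - (x * y)   ≈⟨ -‿cong (-‿distribˡ-* x y) ⟩
      - (- x * y)   ≈⟨ -‿distribʳ-* (- x) y ⟩
      - x * - y     ∎

    *-homo : ∀ i j → ⟦ i ℤ.* j ⟧ ≈ ⟦ i ⟧ * ⟦ j ⟧
    *-homo i j = begin
      ⟦ (ℤ.sign i Sign.* ℤ.sign j) ℤ.◃ (ℤ.∣ i ∣ ℕ.* ℤ.∣ j ∣) ⟧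
        ≈⟨ ◃-homo (ℤ.sign i Sign.* ℤ.sign j) (ℤ.∣ i ∣ ℕ.* ℤ.∣ j ∣) ⟩
      signed (ℤ.sign i Sign.* ℤ.sign j) ((ℤ.∣ i ∣ ℕ.* ℤ.∣ j ∣) · 1#)
        ≈⟨ signed-cong (ℤ.sign i Sign.* ℤ.sign j) (×1-homo-* ℤ.∣ i ∣ ℤ.∣ j ∣) ⟩
      signed (ℤ.sign i Sign.* ℤ.sign j) ((ℤ.∣ i ∣ · 1#) * (ℤ.∣ j ∣ · 1#))
        ≈⟨ signed-* (ℤ.sign i) (ℤ.sign j) _ _ ⟩
      signed (ℤ.sign i) (ℤ.∣ i ∣ · 1#) * signed (ℤ.sign j) (ℤ.∣ j ∣ · 1#)
        ≈⟨ sym (*-cong (signed-abs i) (signed-abs j)) ⟩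
      ⟦ i ⟧ * ⟦ j ⟧ ∎
      where
      signed-cong : ∀ s {x y} → x ≈ y → signed s x ≈ signed s y
      signed-cong Sign.+ e = e
      signed-cong Sign.- e = -‿cong e

    homomorphism : ℤ.+-*-rawRing -Raw-AlmostCommutative⟶ fromCommutativeRing R
    homomorphism = record
      { ⟦_⟧ = ⟦_⟧ ; +-homo = +-homo ; *-homo = *-homo ; -‿homo = -‿homo
      ; 0-homo = refl ; 1-homo = refl }

    equal? : ∀ i j → Maybe (⟦ i ⟧ ≈ ⟦ j ⟧)
    equal? i j with i ℤ.≟ j
    ... | yes ≡.refl = just refl
    ... | no _ = nothing

  open import Algebra.Solver.Ring ℤ.+-*-rawRing (fromCommutativeRing R) homomorphism equal? public
    using (solve; _:+_; _:*_; _:-_; :-_; _:=_; con)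

module OrderedField (F : RealField) where
  open RealField F public
  open import Relation.Binary.Structures using (IsStrictTotalOrder)
  open IsStrictTotalOrder isStrictTotalOrder public using (compare) renaming (trans to <-trans)

  commutativeRing : CommutativeRing _ _
  commutativeRing = record { isCommutativeRing = isCommutativeRing }

  open CommutativeRing commutativeRing public
    using (_-_; +-assoc; +-comm; *-assoc; *-comm; distribˡ; +-identityˡ; +-identityʳ;
           *-identityˡ; *-identityʳ; -‿inverseʳ; zeroˡ; zeroʳ)
  open import Algebra.Properties.Ring (CommutativeRing.ring commutativeRing) public
    using (-0#≈0#)
  open import Algebra.Properties.Group (CommutativeRing.+-group commutativeRing) public
    using () renaming (x∙y⁻¹≈ε⇒x≈y to x-y≡0⇒x≡y; x≈y⇒x∙y⁻¹≈ε to x≡y⇒x-y≡0)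
  open IntegerCoefficients commutativeRing public

  <-irrefl : ∀ {x} → ¬ (x < x)
  <-irrefl = IsStrictTotalOrder.irrefl isStrictTotalOrder ≡.refl

  <⇒≢ : ∀ {x y} → x < y → x ≢ y
  <⇒≢ x<y ≡.refl = <-irrefl x<y

  ≤-trans : ∀ {x y z} → x ≤ y → y ≤ z → x ≤ z
  ≤-trans (inj₁ x<y) (inj₁ y<z) = inj₁ (<-trans x<y y<z)
  ≤-trans (inj₁ x<y) (inj₂ ≡.refl) = inj₁ x<y
  ≤-trans (inj₂ ≡.refl) y≤z = y≤z

  <-≤-trans : ∀ {x y z} → x < y → y ≤ z → x < z
  <-≤-trans x<y (inj₁ y<z) = <-trans x<y y<z
  <-≤-trans x<y (inj₂ ≡.refl) = x<y

  ≤-antisym : ∀ {x y} → x ≤ y → y ≤ x → x ≡ y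
  ≤-antisym (inj₂ x≡y) _ = x≡y
  ≤-antisym (inj₁ x<y) (inj₂ y≡x) = ≡.sym y≡x
  ≤-antisym (inj₁ x<y) (inj₁ y<x) = ⊥-elim (<-irrefl (<-trans x<y y<x))

  ≤∧≢⇒< : ∀ {x y} → x ≤ y → x ≢ y → x < y
  ≤∧≢⇒< (inj₁ x<y) _ = x<y
  ≤∧≢⇒< (inj₂ x≡y) x≢y = ⊥-elim (x≢y x≡y)

  x<y⇒0<y-x : ∀ {x y} → x < y → 0r < y - x
  x<y⇒0<y-x {x} {y} x<y = subst (_< y - x) (-‿inverseʳ x) (+-mono-< (- x) x<y)

  x≤y⇒0≤y-x : ∀ {x y} → x ≤ y → 0r ≤ y - x
  x≤y⇒0≤y-x (inj₁ x<y) = inj₁ (x<y⇒0<y-x x<y)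
  x≤y⇒0≤y-x {x} (inj₂ ≡.refl) = inj₂ (≡.sym (-‿inverseʳ x))

  0≤y-x⇒x≤y : ∀ {x y} → 0r ≤ y - x → x ≤ y
  0≤y-x⇒x≤y {x} {y} (inj₁ 0<y-x) = inj₁ (subst₂ _<_ (+-identityˡ x) y-x+x≡y (+-mono-< x 0<y-x))
    where
    y-x+x≡y : (y - x) + x ≡ y
    y-x+x≡y = solve 2 (λ x y → (y :- x) :+ x := y) ≡.refl x y
  0≤y-x⇒x≤y {x} {y} (inj₂ 0≡y-x) = inj₂ (≡.sym (x-y≡0⇒x≡y y x (≡.sym 0≡y-x)))

  0<x⇒-x<0 : ∀ {x} → 0r < x → - x < 0r
  0<x⇒-x<0 {x} 0<x = subst₂ _<_ (+-identityˡ (- x)) (-‿inverseʳ x) (+-mono-< (- x) 0<x)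

  x<0⇒0<-x : ∀ {x} → x < 0r → 0r < - x
  x<0⇒0<-x {x} x<0 = subst₂ _<_ (-‿inverseʳ x) (+-identityˡ (- x)) (+-mono-< (- x) x<0)

  0<1 : 0r < 1r
  0<1 with compare 0r 1r
  ... | tri< 0<1 _ _ = 0<1
  ... | tri≈ _ 0≡1 _ = ⊥-elim (0≢1 0≡1)
  ... | tri> _ _ 1<0 = ⊥-elim (<-irrefl (<-trans 0<1·1 1<0))
    where
    0<1·1 : 0r < 1r
    0<1·1 = subst (0r <_) (solve 0 (:- con 1ℤ :* :- con 1ℤ := con 1ℤ) ≡.refl)
                  (*-pos (x<0⇒0<-x 1<0) (x<0⇒0<-x 1<0))

  0≤x∧x≢0⇒0<x : ∀ {x} → 0r ≤ x → x ≢ 0r → 0r < x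
  0≤x∧x≢0⇒0<x (inj₁ 0<x) _ = 0<x
  0≤x∧x≢0⇒0<x (inj₂ 0≡x) x≢0 = ⊥-elim (x≢0 (≡.sym 0≡x))

  +-nonneg : ∀ {x y} → 0r ≤ x → 0r ≤ y → 0r ≤ x + y
  +-nonneg {x} {y} 0≤x 0≤y = ≤-trans (subst (_≤ x + 0r) (+-identityˡ 0r) (+-mono-≤ 0r 0≤x))
                                     (subst₂ _≤_ (+-comm 0r x) (+-comm y x) (+-mono-≤ x 0≤y))
    where
    +-mono-≤ : ∀ {u v} w → u ≤ v → u + w ≤ v + w
    +-mono-≤ w (inj₁ u<v) = inj₁ (+-mono-< w u<v)
    +-mono-≤ w (inj₂ ≡.refl) = inj₂ ≡.refl

  +-nonneg-zeroˡ : ∀ {x y} → 0r ≤ x → 0r ≤ y → x + y ≡ 0r → x ≡ 0r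
  +-nonneg-zeroˡ (inj₂ 0≡x) _ _ = ≡.sym 0≡x
  +-nonneg-zeroˡ {x} {y} (inj₁ 0<x) 0≤y x+y≡0 =
    ⊥-elim (<⇒≢ (<-≤-trans 0<x x≤x+y) (≡.sym x+y≡0))
    where
    x≤x+y : x ≤ x + y
    x≤x+y = 0≤y-x⇒x≤y (subst (0r ≤_) (solve 2 (λ x y → y := (x :+ y) :- x) ≡.refl x y) 0≤y)

  *-nonneg : ∀ {x y} → 0r ≤ x → 0r ≤ y → 0r ≤ x * y
  *-nonneg (inj₁ 0<x) (inj₁ 0<y) = inj₁ (*-pos 0<x 0<y)
  *-nonneg {x} (inj₁ _) (inj₂ ≡.refl) = inj₂ (≡.sym (zeroʳ x))
  *-nonneg {y = y} (inj₂ ≡.refl) _ = inj₂ (≡.sym (zeroˡ y))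

  *-monoˡ-≤-nonneg : ∀ {x y} z → 0r ≤ z → x ≤ y → x * z ≤ y * z
  *-monoˡ-≤-nonneg {x} {y} z 0≤z x≤y =
    0≤y-x⇒x≤y (subst (0r ≤_) (solve 3 (λ x y z → (y :- x) :* z := y :* z :- x :* z) ≡.refl x y z)
                                (*-nonneg (x≤y⇒0≤y-x x≤y) 0≤z))

  *-cancelʳ-zero : ∀ {x a} → 0r < a → x * a ≡ 0r → x ≡ 0r
  *-cancelʳ-zero {x} {a} 0<a xa≡0 with inverse a (λ a≡0 → <⇒≢ 0<a (≡.sym a≡0))
  ... | a⁻¹ , aa⁻¹≡1 = begin
    x                ≡⟨ ≡.sym (*-identityʳ x) ⟩
    x * 1r           ≡⟨ cong (x *_) (≡.sym aa⁻¹≡1) ⟩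
    x * (a * a⁻¹)    ≡⟨ ≡.sym (*-assoc x a a⁻¹) ⟩
    (x * a) * a⁻¹    ≡⟨ cong (_* a⁻¹) xa≡0 ⟩
    0r * a⁻¹         ≡⟨ zeroˡ a⁻¹ ⟩
    0r               ∎
    where open ≡.≡-Reasoning

  *-cancelʳ-pos : ∀ {x y a} → 0r < a → x * a ≡ y * a → x ≡ y
  *-cancelʳ-pos {x} {y} {a} 0<a xa≡ya = x-y≡0⇒x≡y x y (*-cancelʳ-zero 0<a (≡.trans
    (solve 3 (λ x y a → (x :- y) :* a := x :* a :- y :* a) ≡.refl x y a) (x≡y⇒x-y≡0 xa≡ya)))

  *-zero⇒⊎ : ∀ {x y} → x * y ≡ 0r → x ≡ 0r ⊎ y ≡ 0r
  *-zero⇒⊎ {x} {y} xy≡0 with compare x 0r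
  ... | tri≈ _ x≡0 _ = inj₁ x≡0
  ... | tri> _ _ 0<x = inj₂ (*-cancelʳ-zero 0<x (≡.trans (*-comm y x) xy≡0))
  ... | tri< x<0 _ _ = inj₂ (*-cancelʳ-zero (x<0⇒0<-x x<0) y[-x]≡0)
    where
    y[-x]≡0 : y * - x ≡ 0r
    y[-x]≡0 = ≡.trans (solve 2 (λ x y → y :* :- x := :- (x :* y)) ≡.refl x y)
                      (≡.trans (cong -_ xy≡0) -0#≈0#)

  *-cancelˡ-pos : ∀ {k y} → 0r < k → 0r < k * y → 0r < y
  *-cancelˡ-pos {k} {y} 0<k 0<ky with compare 0r y
  ... | tri< 0<y _ _ = 0<y
  ... | tri≈ _ ≡.refl _ = ⊥-elim (<⇒≢ 0<ky (≡.sym (zeroʳ k)))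
  ... | tri> _ _ y<0 = ⊥-elim (<-irrefl (<-trans 0<ky ky<0))
    where
    ky<0 : k * y < 0r
    ky<0 = subst (_< 0r) (solve 2 (λ k y → :- (k :* :- y) := k :* y) ≡.refl k y)
                 (0<x⇒-x<0 (*-pos 0<k (x<0⇒0<-x y<0)))

  inverse-pos : ∀ x → 0r < x → ∃ λ y → 0r < y × x * y ≡ 1r
  inverse-pos x 0<x with inverse x (λ x≡0 → <⇒≢ 0<x (≡.sym x≡0))
  ... | y , xy≡1 = y , *-cancelˡ-pos 0<x (subst (0r <_) (≡.sym xy≡1) 0<1) , xy≡1

  x+y≡z⇒x≡z-y : ∀ {x y z} → x + y ≡ z → x ≡ z - y
  x+y≡z⇒x≡z-y {x} {y} x+y≡z = ≡.trans (solve 2 (λ x y → x := (x :+ y) :- y) ≡.refl x y) (cong (_- y) x+y≡z)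

  x≡1⇒1-x≡0 : ∀ {x} → x ≡ 1r → 1r - x ≡ 0r
  x≡1⇒1-x≡0 x≡1 = x≡y⇒x-y≡0 (≡.sym x≡1)

  1-x≡0⇒x≡1 : ∀ {x} → 1r - x ≡ 0r → x ≡ 1r
  1-x≡0⇒x≡1 {x} 1-x≡0 = ≡.sym (x-y≡0⇒x≡y 1r x 1-x≡0)

  cramer₂ : ∀ {c c₁ c₂ p q d} → c₁ ≡ c - p * c₂ → c₂ ≡ c - q * c₁ → (1r - p * q) * d ≡ 1r →
            c₁ ≡ c * ((1r - p) * d) × c₂ ≡ c * ((1r - q) * d)
  cramer₂ {c} {c₁} {c₂} {p} {q} {d} e₁ e₂ det =
    solve-for c₁ c₂ p q (x≡y⇒x-y≡0 e₁) (x≡y⇒x-y≡0 e₂) det ,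
    solve-for c₂ c₁ q p (x≡y⇒x-y≡0 e₂) (x≡y⇒x-y≡0 e₁) (≡.trans (cong (λ t → (1r - t) * d) (*-comm q p)) det)
    where
    open ≡.≡-Reasoning
    solve-for : ∀ x y p′ q′ → x - (c - p′ * y) ≡ 0r → y - (c - q′ * x) ≡ 0r → (1r - p′ * q′) * d ≡ 1r →
                x ≡ c * ((1r - p′) * d)
    solve-for x y p′ q′ r₁≡0 r₂≡0 det′ = begin
      x
        ≡⟨ ≡.sym (*-identityʳ x) ⟩
      x * 1r
        ≡⟨ cong (x *_) (≡.sym det′) ⟩
      x * ((1r - p′ * q′) * d)
        ≡⟨ solve 6 (λ x y c p q d → x :* ((con 1ℤ :- p :* q) :* d)
                       := (c :* (con 1ℤ :- p) :+ (x :- (c :- p :* y)) :+ :- p :* (y :- (c :- q :* x))) :* d)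
                   ≡.refl x y c p′ q′ d ⟩
      (c * (1r - p′) + (x - (c - p′ * y)) + - p′ * (y - (c - q′ * x))) * d
        ≡⟨ cong₂ (λ u v → (c * (1r - p′) + u + - p′ * v) * d) r₁≡0 r₂≡0 ⟩
      (c * (1r - p′) + 0r + - p′ * 0r) * d
        ≡⟨ solve 3 (λ c p d → (c :* (con 1ℤ :- p) :+ con (ℤ.+ 0) :+ :- p :* con (ℤ.+ 0)) :* d
                              := c :* ((con 1ℤ :- p) :* d)) ≡.refl c p′ d ⟩
      c * ((1r - p′) * d) ∎

  *-≤ˡ : ∀ {u v} → 0r ≤ u → v ≤ 1r → u * v ≤ u
  *-≤ˡ {u} {v} 0≤u v≤1 = subst₂ _≤_ (*-comm v u) (*-identityˡ u) (*-monoˡ-≤-nonneg u 0≤u v≤1)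

  *-≡1-unit-interval : ∀ {u v} → 0r ≤ u → u ≤ 1r → v ≤ 1r → u * v ≡ 1r → u ≡ 1r × v ≡ 1r
  *-≡1-unit-interval {u} {v} 0≤u u≤1 v≤1 uv≡1 = u≡1 , v≡1
    where
    u≡1 : u ≡ 1r
    u≡1 = ≤-antisym u≤1 (subst (_≤ u) uv≡1 (*-≤ˡ 0≤u v≤1))
    v≡1 : v ≡ 1r
    v≡1 = ≡.trans (≡.sym (*-identityˡ v)) (≡.trans (cong (_* v) (≡.sym u≡1)) uv≡1)

⪯-refl : ∀ {t} {p : Pos t} → p ⪯ p
⪯-refl {p = here} = ⪯-here
⪯-refl {p = goL p} = ⪯-L ⪯-refl
⪯-refl {p = goR p} = ⪯-R ⪯-refl

⪯-trans : ∀ {t} {p q s : Pos t} → p ⪯ q → q ⪯ s → p ⪯ s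
⪯-trans ⪯-here _ = ⪯-here
⪯-trans (⪯-L p⪯q) (⪯-L q⪯s) = ⪯-L (⪯-trans p⪯q q⪯s)
⪯-trans (⪯-R p⪯q) (⪯-R q⪯s) = ⪯-R (⪯-trans p⪯q q⪯s)

meet-⪯ʳ : ∀ {t} (p q : Pos t) → meet p q ⪯ q
meet-⪯ʳ here q = ⪯-here
meet-⪯ʳ (goL p) here = ⪯-here
meet-⪯ʳ (goR p) here = ⪯-here
meet-⪯ʳ (goL p) (goL q) = ⪯-L (meet-⪯ʳ p q)
meet-⪯ʳ (goL p) (goR q) = ⪯-here
meet-⪯ʳ (goR p) (goL q) = ⪯-here
meet-⪯ʳ (goR p) (goR q) = ⪯-R (meet-⪯ʳ p q)

meet-idem : ∀ {t} (p : Pos t) → meet p p ≡ p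
meet-idem here = ≡.refl
meet-idem (goL p) = cong goL (meet-idem p)
meet-idem (goR p) = cong goR (meet-idem p)

deeper-goR : ∀ {l r} (p q : Pos r) → deeper (goR {l} {r} p) (goR q) ≡ goR (deeper p q)
deeper-goR p q with depth p <ᵇ depth q
... | true = ≡.refl
... | false = ≡.refl

cmp≡eq⇒≡ : ∀ {t} (p q : Pos t) → cmp p q ≡ eq → p ≡ q
cmp≡eq⇒≡ here here _ = ≡.refl
cmp≡eq⇒≡ (goL p) (goL q) e = cong goL (cmp≡eq⇒≡ p q e)
cmp≡eq⇒≡ (goR p) (goR q) e = cong goR (cmp≡eq⇒≡ p q e)
cmp≡eq⇒≡ here (goL q) ()
cmp≡eq⇒≡ here (goR q) ()
cmp≡eq⇒≡ (goL p) here ()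
cmp≡eq⇒≡ (goR p) here ()
cmp≡eq⇒≡ (goL p) (goR q) ()
cmp≡eq⇒≡ (goR p) (goL q) ()

cmp≡anc⇒¬leaf : ∀ {t} (p q : Pos t) → cmp p q ≡ anc → ¬ IsLeaf p
cmp≡anc⇒¬leaf here (goL q) _ ()
cmp≡anc⇒¬leaf here (goR q) _ ()
cmp≡anc⇒¬leaf (goL p) (goL q) e = cmp≡anc⇒¬leaf p q e
cmp≡anc⇒¬leaf (goR p) (goR q) e = cmp≡anc⇒¬leaf p q e
cmp≡anc⇒¬leaf here here ()
cmp≡anc⇒¬leaf (goL p) here ()
cmp≡anc⇒¬leaf (goR p) here ()
cmp≡anc⇒¬leaf (goL p) (goR q) ()
cmp≡anc⇒¬leaf (goR p) (goL q) ()

cmp≡desc⇒¬leaf : ∀ {t} (p q : Pos t) → cmp p q ≡ desc → ¬ IsLeaf q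
cmp≡desc⇒¬leaf p q e = cmp≡anc⇒¬leaf q p (cmp-flip p q e)
  where
  cmp-flip : ∀ {t} (p q : Pos t) → cmp p q ≡ desc → cmp q p ≡ anc
  cmp-flip (goL p) here _ = ≡.refl
  cmp-flip (goR p) here _ = ≡.refl
  cmp-flip (goL p) (goL q) e = cmp-flip p q e
  cmp-flip (goR p) (goR q) e = cmp-flip p q e
  cmp-flip here here ()
  cmp-flip here (goL q) ()
  cmp-flip here (goR q) ()
  cmp-flip (goL p) (goR q) ()
  cmp-flip (goR p) (goL q) ()

last-isLeaf : ∀ t → IsLeaf (last t)
last-isLeaf leaf = ≡.refl
last-isLeaf (node l r) = last-isLeaf r

cmp-last≢gt : ∀ {t} (p : Pos t) → cmp p (last t) ≢ gt
cmp-last≢gt {leaf} here ()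
cmp-last≢gt {node l r} here ()
cmp-last≢gt {node l r} (goL p) ()
cmp-last≢gt {node l r} (goR p) e = cmp-last≢gt p e

goL-injective : ∀ {l r} {p q : Pos l} → goL {l} {r} p ≡ goL q → p ≡ q
goL-injective ≡.refl = ≡.refl

goR-injective : ∀ {l r} {p q : Pos r} → goR {l} {r} p ≡ goR q → p ≡ q
goR-injective ≡.refl = ≡.refl

ChildOf⇒⪯ : ∀ {t} {p c : Pos t} {s} → ChildOf p c s → p ⪯ c
ChildOf⇒⪯ ch-L = ⪯-here
ChildOf⇒⪯ ch-R = ⪯-here
ChildOf⇒⪯ (ch-inL ch) = ⪯-L (ChildOf⇒⪯ ch)
ChildOf⇒⪯ (ch-inR ch) = ⪯-R (ChildOf⇒⪯ ch)

minus-child-off-spine : ∀ {t} {p c : Pos t} → ChildOf p c minus → ¬ (c ⪯ last t)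
minus-child-off-spine ch-L ()
minus-child-off-spine (ch-inL ch) ()
minus-child-off-spine (ch-inR ch) (⪯-R c⪯last) = minus-child-off-spine ch c⪯last

below-distinct-children : ∀ {t} {p c₁ c₂ i j : Pos t} → ChildOf p c₁ minus → ChildOf p c₂ plus →
                          c₁ ⪯ i → c₂ ⪯ j → i ≢ j
below-distinct-children ch-L ch-R (⪯-L _) (⪯-R _) ()
below-distinct-children (ch-inL ch₁) (ch-inL ch₂) (⪯-L c₁⪯i) (⪯-L c₂⪯j) i≡j =
  below-distinct-children ch₁ ch₂ c₁⪯i c₂⪯j (goL-injective i≡j)
below-distinct-children (ch-inR ch₁) (ch-inR ch₂) (⪯-R c₁⪯i) (⪯-R c₂⪯j) i≡j =
  below-distinct-children ch₁ ch₂ c₁⪯i c₂⪯j (goR-injective i≡j)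

leaf-last-or-off-spine : ∀ {t} (i : Pos t) → IsLeaf i →
  i ≡ last t ⊎ ∃ λ M → ∃ λ c → M ⪯ last t × ChildOf M c minus × c ⪯ i
leaf-last-or-off-spine {leaf} here _ = inj₁ ≡.refl
leaf-last-or-off-spine {node l r} (goL i) _ = inj₂ (here , goL here , ⪯-here , ch-L , ⪯-L ⪯-here)
leaf-last-or-off-spine {node l r} (goR i) i-leaf with leaf-last-or-off-spine i i-leaf
... | inj₁ i≡last = inj₁ (cong goR i≡last)
... | inj₂ (M , c , M⪯last , ch , c⪯i) = inj₂ (goR M , goR c , ⪯-R M⪯last , ch-inR ch , ⪯-R c⪯i)

module FiniteSums (F : RealField) where
  open OrderedField F

  ∑[_]_ : ∀ {A : Set} → List A → (A → ℝ) → ℝ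
  ∑[ xs ] f = sumL F f xs

  ∑-++ : ∀ {A : Set} (f : A → ℝ) xs ys → ∑[ xs ++ ys ] f ≡ ∑[ xs ] f + ∑[ ys ] f
  ∑-++ f [] ys = ≡.sym (+-identityˡ _)
  ∑-++ f (x ∷ xs) ys = ≡.trans (cong (f x +_) (∑-++ f xs ys)) (≡.sym (+-assoc _ _ _))

  ∑-map : ∀ {A B : Set} (f : B → ℝ) (g : A → B) xs → ∑[ map g xs ] f ≡ ∑[ xs ] (λ x → f (g x))
  ∑-map f g [] = ≡.refl
  ∑-map f g (x ∷ xs) = cong (f (g x) +_) (∑-map f g xs)

  ∑-cong : ∀ {A : Set} {f g : A → ℝ} xs → (∀ x → f x ≡ g x) → ∑[ xs ] f ≡ ∑[ xs ] g
  ∑-cong [] _ = ≡.refl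
  ∑-cong (x ∷ xs) f≗g = cong₂ _+_ (f≗g x) (∑-cong xs f≗g)

  ∑-*ˡ : ∀ {A : Set} (k : ℝ) (f : A → ℝ) xs → ∑[ xs ] (λ x → k * f x) ≡ k * ∑[ xs ] f
  ∑-*ˡ k f [] = ≡.sym (zeroʳ k)
  ∑-*ˡ k f (x ∷ xs) = ≡.trans (cong (k * f x +_) (∑-*ˡ k f xs)) (≡.sym (distribˡ k _ _))

  ∑-zeroʳ : ∀ {A : Set} (f : A → ℝ) xs → ∑[ xs ] (λ x → f x * 0r) ≡ 0r
  ∑-zeroʳ f [] = ≡.refl
  ∑-zeroʳ f (x ∷ xs) = ≡.trans (cong₂ _+_ (zeroʳ (f x)) (∑-zeroʳ f xs)) (+-identityˡ 0r)

  ∑-- : ∀ {A : Set} (f g : A → ℝ) xs → ∑[ xs ] (λ x → f x - g x) ≡ ∑[ xs ] f - ∑[ xs ] g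
  ∑-- f g [] = ≡.sym (-‿inverseʳ 0r)
  ∑-- f g (x ∷ xs) = ≡.trans (cong ((f x - g x) +_) (∑-- f g xs))
    (solve 4 (λ a b c d → (a :- b) :+ (c :- d) := (a :+ c) :- (b :+ d)) ≡.refl (f x) (g x) _ _)

  ∑-node : ∀ l r (f : Pos (node l r) → ℝ) →
           ∑[ leaves (node l r) ] f ≡ ∑[ leaves l ] (λ p → f (goL p)) + ∑[ leaves r ] (λ p → f (goR p))
  ∑-node l r f = ≡.trans (∑-++ f (map goL (leaves l)) (map goR (leaves r)))
                         (cong₂ _+_ (∑-map f goL (leaves l)) (∑-map f goR (leaves r)))

  ∑-leavesUnder-goL : ∀ {l r} (L : Pos l) (f : Pos (node l r) → ℝ) →
                      ∑[ leavesUnder (goL {l} {r} L) ] f ≡ ∑[ leavesUnder L ] (λ p → f (goL p))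
  ∑-leavesUnder-goL L f = ≡.trans (∑-map f (extend (goL L)) (leaves (sub L))) (≡.sym (∑-map _ (extend L) (leaves (sub L))))

  ∑-leavesUnder-goR : ∀ {l r} (L : Pos r) (f : Pos (node l r) → ℝ) →
                      ∑[ leavesUnder (goR {l} {r} L) ] f ≡ ∑[ leavesUnder L ] (λ p → f (goR p))
  ∑-leavesUnder-goR L f = ≡.trans (∑-map f (extend (goR L)) (leaves (sub L))) (≡.sym (∑-map _ (extend L) (leaves (sub L))))

  ∑-leaves-cong : ∀ t {f g : Pos t → ℝ} → (∀ i → IsLeaf i → f i ≡ g i) →
                  ∑[ leaves t ] f ≡ ∑[ leaves t ] g
  ∑-leaves-cong leaf f≗g = cong (_+ 0r) (f≗g here ≡.refl)
  ∑-leaves-cong (node l r) {f} {g} f≗g = begin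
    ∑[ leaves (node l r) ] f
      ≡⟨ ∑-node l r f ⟩
    ∑[ leaves l ] (λ p → f (goL p)) + ∑[ leaves r ] (λ p → f (goR p))
      ≡⟨ cong₂ _+_ (∑-leaves-cong l (λ i → f≗g (goL i))) (∑-leaves-cong r (λ i → f≗g (goR i))) ⟩
    ∑[ leaves l ] (λ p → g (goL p)) + ∑[ leaves r ] (λ p → g (goR p))
      ≡⟨ ≡.sym (∑-node l r g) ⟩
    ∑[ leaves (node l r) ] g ∎
    where open ≡.≡-Reasoning

module Nonsingularity (F : RealField) where
  open OrderedField F
  open FiniteSums F

  δ : ∀ {t} → Pos t → Pos t → ℝ
  δ here here = 1r
  δ (goL p) (goL q) = δ p q
  δ (goR p) (goR q) = δ p q
  δ _ _ = 0r

  δ-refl : ∀ {t} (p : Pos t) → δ p p ≡ 1r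
  δ-refl here = ≡.refl
  δ-refl (goL p) = δ-refl p
  δ-refl (goR p) = δ-refl p

  δ-≢ : ∀ {t} (p q : Pos t) → p ≢ q → δ p q ≡ 0r
  δ-≢ here here p≢q = ⊥-elim (p≢q ≡.refl)
  δ-≢ (goL p) (goL q) p≢q = δ-≢ p q (λ p≡q → p≢q (cong goL p≡q))
  δ-≢ (goR p) (goR q) p≢q = δ-≢ p q (λ p≡q → p≢q (cong goR p≡q))
  δ-≢ here (goL q) _ = ≡.refl
  δ-≢ here (goR q) _ = ≡.refl
  δ-≢ (goL p) here _ = ≡.refl
  δ-≢ (goL p) (goR q) _ = ≡.refl
  δ-≢ (goR p) here _ = ≡.refl
  δ-≢ (goR p) (goL q) _ = ≡.refl

  ∑-δ : ∀ t (f : Pos t → ℝ) i → IsLeaf i → ∑[ leaves t ] (λ p → f p * δ i p) ≡ f i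
  ∑-δ leaf f here _ = ≡.trans (+-identityʳ _) (*-identityʳ _)
  ∑-δ (node l r) f (goL i) i-leaf = begin
    ∑[ leaves (node l r) ] (λ p → f p * δ (goL i) p)
      ≡⟨ ∑-node l r _ ⟩
    ∑[ leaves l ] (λ p → f (goL p) * δ i p) + ∑[ leaves r ] (λ p → f (goR p) * 0r)
      ≡⟨ cong₂ _+_ (∑-δ l (λ p → f (goL p)) i i-leaf) (∑-zeroʳ (λ p → f (goR p)) (leaves r)) ⟩
    f (goL i) + 0r
      ≡⟨ +-identityʳ _ ⟩
    f (goL i) ∎
    where open ≡.≡-Reasoning
  ∑-δ (node l r) f (goR i) i-leaf = begin
    ∑[ leaves (node l r) ] (λ p → f p * δ (goR i) p)
      ≡⟨ ∑-node l r _ ⟩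
    ∑[ leaves l ] (λ p → f (goL p) * 0r) + ∑[ leaves r ] (λ p → f (goR p) * δ i p)
      ≡⟨ cong₂ _+_ (∑-zeroʳ (λ p → f (goL p)) (leaves l)) (∑-δ r (λ p → f (goR p)) i i-leaf) ⟩
    0r + f (goR i)
      ≡⟨ +-identityˡ _ ⟩
    f (goR i) ∎
    where open ≡.≡-Reasoning

  module _ {T : Tree} {U : Pos T → Pos T → ℝ} (U-nonsingular : Nonsingular F T U) where

    distinct-columns : ∀ i j → IsLeaf i → IsLeaf j → i ≢ j → ¬ (∀ k → IsLeaf k → U k i ≡ U k j)
    distinct-columns i j i-leaf j-leaf i≢j same-column = 0≢1 (begin
      0r                ≡⟨ ≡.sym (U-nonsingular x Ux≡0 i i-leaf) ⟩
      δ i i - δ j i     ≡⟨ cong₂ _-_ (δ-refl i) (δ-≢ j i (λ j≡i → i≢j (≡.sym j≡i))) ⟩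
      1r - 0r           ≡⟨ solve 0 (con 1ℤ :- con (ℤ.+ 0) := con 1ℤ) ≡.refl ⟩
      1r                ∎)
      where
      open ≡.≡-Reasoning
      x : Pos T → ℝ
      x p = δ i p - δ j p
      Ux≡0 : ∀ k → IsLeaf k → ∑[ leaves T ] (λ p → U k p * x p) ≡ 0r
      Ux≡0 k k-leaf = begin
        ∑[ leaves T ] (λ p → U k p * x p)
          ≡⟨ ∑-cong (leaves T) (λ p → solve 3 (λ u d e → u :* (d :- e) := u :* d :- u :* e) ≡.refl (U k p) (δ i p) (δ j p)) ⟩
        ∑[ leaves T ] (λ p → U k p * δ i p - U k p * δ j p)
          ≡⟨ ∑-- _ _ (leaves T) ⟩
        ∑[ leaves T ] (λ p → U k p * δ i p) - ∑[ leaves T ] (λ p → U k p * δ j p)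
          ≡⟨ cong₂ _-_ (∑-δ T (U k) i i-leaf) (∑-δ T (U k) j j-leaf) ⟩
        U k i - U k j
          ≡⟨ x≡y⇒x-y≡0 (same-column k k-leaf) ⟩
        0r ∎

    nonzero-column : ∀ i → IsLeaf i → ¬ (∀ k → IsLeaf k → U k i ≡ 0r)
    nonzero-column i i-leaf zero-column = 0≢1 (begin
      0r       ≡⟨ ≡.sym (U-nonsingular (δ i) Uδ≡0 i i-leaf) ⟩
      δ i i    ≡⟨ δ-refl i ⟩
      1r       ∎)
      where
      open ≡.≡-Reasoning
      Uδ≡0 : ∀ k → IsLeaf k → ∑[ leaves T ] (λ p → U k p * δ i p) ≡ 0r
      Uδ≡0 k k-leaf = ≡.trans (∑-δ T (U k) i i-leaf) (zero-column k k-leaf)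

module LocalMatrix (F : RealField) where
  open OrderedField F
  open FiniteSums F

  OnSpine : Bool → (S : Tree) → Pos S → Set
  OnSpine true S p = p ⪯ last S
  OnSpine false S p = ⊥

  ¬OnSpine-goL : ∀ sp {l r} (p : Pos l) → ¬ OnSpine sp (node l r) (goL p)
  ¬OnSpine-goL true p ()
  ¬OnSpine-goL false p ()

  OnSpine-goR : ∀ sp {l r} (p : Pos r) → OnSpine sp r p → OnSpine sp (node l r) (goR p)
  OnSpine-goR true p p⪯last = ⪯-R p⪯last
  OnSpine-goR false p ()

  OnSpine-goR⁻ : ∀ sp {l r} (p : Pos r) → OnSpine sp (node l r) (goR p) → OnSpine sp r p
  OnSpine-goR⁻ true p (⪯-R p⪯last) = p⪯last
  OnSpine-goR⁻ false p ()

  -- The flag records whether the subtree carries the distinguished leaf n (as its last leaf);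
  -- in a subtree hanging off geod(r, n) rule (v) reads U i j = b (i ∧ j) for j < i.
  lowerEntryVertex : Bool → (S : Tree) → Pos S → Pos S → Pos S
  lowerEntryVertex true S i j = deeper (meet i j) (meet i (last S))
  lowerEntryVertex false S i j = meet i j

  Ũ : Bool → (S : Tree) → (Pos S → ℝ) → (Pos S → ℝ) → Pos S → Pos S → ℝ
  Ũ sp S a b i j with cmp i j
  ... | eq = a i
  ... | lt = a (meet i j)
  ... | gt = b (lowerEntryVertex sp S i j)
  ... | anc = 0r
  ... | desc = 0r

  Umat≡Ũ : ∀ T α β i j → Umat F T α β i j ≡ Ũ true T α β i j
  Umat≡Ũ T α β i j with cmp i j
  ... | eq = ≡.refl
  ... | lt = ≡.refl
  ... | gt = ≡.refl
  ... | anc = ≡.refl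
  ... | desc = ≡.refl

  module _ {l r : Tree} (a b : Pos (node l r) → ℝ) where
    aL bL : Pos l → ℝ
    aL p = a (goL p)
    bL p = b (goL p)
    aR bR : Pos r → ℝ
    aR p = a (goR p)
    bR p = b (goR p)

    Ũ-goL : ∀ sp i j → Ũ sp (node l r) a b (goL i) (goL j) ≡ Ũ false l aL bL i j
    Ũ-goL sp i j with cmp i j
    ... | eq = ≡.refl
    ... | lt = ≡.refl
    ... | gt = lowerEntryVertex-goL sp
      where
      lowerEntryVertex-goL : ∀ sp → b (lowerEntryVertex sp (node l r) (goL i) (goL j)) ≡ bL (meet i j)
      lowerEntryVertex-goL true = ≡.refl
      lowerEntryVertex-goL false = ≡.refl
    ... | anc = ≡.refl
    ... | desc = ≡.refl

    Ũ-goR : ∀ sp i j → Ũ sp (node l r) a b (goR i) (goR j) ≡ Ũ sp r aR bR i j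
    Ũ-goR sp i j with cmp i j
    ... | eq = ≡.refl
    ... | lt = ≡.refl
    ... | gt = lowerEntryVertex-goR sp
      where
      lowerEntryVertex-goR : ∀ sp → b (lowerEntryVertex sp (node l r) (goR i) (goR j)) ≡ bR (lowerEntryVertex sp r i j)
      lowerEntryVertex-goR true = cong b (deeper-goR (meet i j) (meet i (last r)))
      lowerEntryVertex-goR false = ≡.refl
    ... | anc = ≡.refl
    ... | desc = ≡.refl

  InΓ : (sp : Bool) (S : Tree) (a b : Pos S → ℝ) → Pos S → Side → Set
  InΓ sp S a b L minus =
    OnSpine sp S L ⊎
    (¬ OnSpine sp S L × ∃ λ i → IsLeaf i × (∃ λ c → ChildOf L c plus × c ⪯ i) × b L ≡ b i)
  InΓ sp S a b L plus =
    ¬ OnSpine sp S L × ∃ λ i → IsLeaf i × (∃ λ c → ChildOf L c minus × c ⪯ i) × a L ≡ a i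

  Avoids : (sp : Bool) (S : Tree) (a b : Pos S → ℝ) → Pos S → Pos S → Set
  Avoids sp S a b i L = ∀ p c s → ChildOf p c s → L ⪯ p → c ⪯ i → ¬ InΓ sp S a b p s

  module _ {T : Tree} {α β : Pos T → ℝ} {i L : Pos T} where
    Avoids⇒GeodAvoidsΓᵗ : Avoids true T α β i L → GeodAvoidsΓᵗ F T α β i L
    Avoids⇒GeodAvoidsΓᵗ avoids p c minus = avoids p c minus
    Avoids⇒GeodAvoidsΓᵗ avoids p c plus = avoids p c plus

    GeodAvoidsΓᵗ⇒Avoids : GeodAvoidsΓᵗ F T α β i L → Avoids true T α β i L
    GeodAvoidsΓᵗ⇒Avoids avoids p c minus = avoids p c minus
    GeodAvoidsΓᵗ⇒Avoids avoids p c plus = avoids p c plus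

  IsSolutionᵗ : (sp : Bool) (S : Tree) (a b : Pos S → ℝ) → (Pos S → ℝ) → ℝ → Set
  IsSolutionᵗ sp S a b x c = ∀ j → IsLeaf j → ∑[ leaves S ] (λ i → Ũ sp S a b i j * x i) ≡ c

  IsPotential : (sp : Bool) (S : Tree) (a b : Pos S → ℝ) → Pos S → (Pos S → ℝ) → Set
  IsPotential sp S a b L ν = IsPotentialᵗ F S (Ũ sp S a b) L ν

  Umat-potential⇒IsPotential : ∀ {T α β L ν} → IsPotentialᵗ F T (Umat F T α β) L ν → IsPotential true T α β L ν
  Umat-potential⇒IsPotential {T} {α} {β} {L} {ν} pot j j-leaf L⪯j =
    ≡.trans (∑-cong (leavesUnder L) (λ i → cong (_* ν i) (≡.sym (Umat≡Ũ T α β i j)))) (pot j j-leaf L⪯j)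

  potential-root : ∀ sp S a b ν → IsPotential sp S a b here ν → IsSolutionᵗ sp S a b ν 1r
  potential-root sp S a b ν pot j j-leaf = ≡.trans (≡.sym (∑-map _ (extend here) (leaves S))) (pot j j-leaf ⪯-here)

  -- The last three fields are all the recursion needs from nonsingularity (see NonDegeneracy).
  record Admissible (sp : Bool) (S : Tree) (a b : Pos S → ℝ) : Set where
    field
      a-nonneg : ∀ p → 0r ≤ a p
      a≤b : ∀ p → a p ≤ b p
      leaf-eq : ∀ p → IsLeaf p → a p ≡ b p
      a-mono : ∀ p q → p ⪯ q → a p ≤ a q
      b-mono : ∀ p q → p ⪯ q → b p ≤ b q
      spine-eq : ∀ p → OnSpine sp S p → a p ≡ b p
      leaf-nonzero : ∀ p → IsLeaf p → a p ≢ 0r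
      no-tie-on-spine : ∀ p c i → OnSpine sp S p → ChildOf p c minus → c ⪯ i → IsLeaf i → b i ≢ a p
      no-tie-off-spine : ∀ p c₁ c₂ i j → ¬ OnSpine sp S p → ChildOf p c₁ minus → ChildOf p c₂ plus →
        c₁ ⪯ i → c₂ ⪯ j → IsLeaf i → IsLeaf j → b i ≡ a p → b j ≢ a p

  module _ {sp : Bool} {l r : Tree} {a b : Pos (node l r) → ℝ} where

    Admissible-goL : Admissible sp (node l r) a b → Admissible false l (aL a b) (bL a b)
    Admissible-goL adm = record
      { a-nonneg = λ p → a-nonneg (goL p)
      ; a≤b = λ p → a≤b (goL p)
      ; leaf-eq = λ p → leaf-eq (goL p)
      ; a-mono = λ p q p⪯q → a-mono (goL p) (goL q) (⪯-L p⪯q)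
      ; b-mono = λ p q p⪯q → b-mono (goL p) (goL q) (⪯-L p⪯q)
      ; spine-eq = λ p ()
      ; leaf-nonzero = λ p → leaf-nonzero (goL p)
      ; no-tie-on-spine = λ p c i ()
      ; no-tie-off-spine = λ p c₁ c₂ i j _ ch₁ ch₂ c₁⪯i c₂⪯j →
          no-tie-off-spine (goL p) (goL c₁) (goL c₂) (goL i) (goL j) (¬OnSpine-goL sp p)
            (ch-inL ch₁) (ch-inL ch₂) (⪯-L c₁⪯i) (⪯-L c₂⪯j)
      }
      where open Admissible adm

    Admissible-goR : Admissible sp (node l r) a b → Admissible sp r (aR a b) (bR a b)
    Admissible-goR adm = record
      { a-nonneg = λ p → a-nonneg (goR p)
      ; a≤b = λ p → a≤b (goR p)
      ; leaf-eq = λ p → leaf-eq (goR p)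
      ; a-mono = λ p q p⪯q → a-mono (goR p) (goR q) (⪯-R p⪯q)
      ; b-mono = λ p q p⪯q → b-mono (goR p) (goR q) (⪯-R p⪯q)
      ; spine-eq = λ p p-spine → spine-eq (goR p) (OnSpine-goR sp p p-spine)
      ; leaf-nonzero = λ p → leaf-nonzero (goR p)
      ; no-tie-on-spine = λ p c i p-spine ch c⪯i →
          no-tie-on-spine (goR p) (goR c) (goR i) (OnSpine-goR sp p p-spine) (ch-inR ch) (⪯-R c⪯i)
      ; no-tie-off-spine = λ p c₁ c₂ i j p-off ch₁ ch₂ c₁⪯i c₂⪯j →
          no-tie-off-spine (goR p) (goR c₁) (goR c₂) (goR i) (goR j) (p-off ∘ OnSpine-goR⁻ sp p)
            (ch-inR ch₁) (ch-inR ch₂) (⪯-R c₁⪯i) (⪯-R c₂⪯j)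
      }
      where open Admissible adm

    InΓ-goL⇒ : ∀ p s → InΓ false l (aL a b) (bL a b) p s → InΓ sp (node l r) a b (goL p) s
    InΓ-goL⇒ p minus (inj₁ ())
    InΓ-goL⇒ p minus (inj₂ (_ , i , i-leaf , (c , ch , c⪯i) , e)) =
      inj₂ (¬OnSpine-goL sp p , goL i , i-leaf , (goL c , ch-inL ch , ⪯-L c⪯i) , e)
    InΓ-goL⇒ p plus (_ , i , i-leaf , (c , ch , c⪯i) , e) =
      ¬OnSpine-goL sp p , goL i , i-leaf , (goL c , ch-inL ch , ⪯-L c⪯i) , e

    InΓ-goL⇐ : ∀ p s → InΓ sp (node l r) a b (goL p) s → InΓ false l (aL a b) (bL a b) p s
    InΓ-goL⇐ p minus (inj₁ p-spine) = ⊥-elim (¬OnSpine-goL sp p p-spine)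
    InΓ-goL⇐ p minus (inj₂ (_ , .(goL _) , i-leaf , (.(goL _) , ch-inL ch , ⪯-L c⪯i) , e)) =
      inj₂ ((λ ()) , _ , i-leaf , (_ , ch , c⪯i) , e)
    InΓ-goL⇐ p plus (_ , .(goL _) , i-leaf , (.(goL _) , ch-inL ch , ⪯-L c⪯i) , e) =
      (λ ()) , _ , i-leaf , (_ , ch , c⪯i) , e

    InΓ-goR⇒ : ∀ p s → InΓ sp r (aR a b) (bR a b) p s → InΓ sp (node l r) a b (goR p) s
    InΓ-goR⇒ p minus (inj₁ p-spine) = inj₁ (OnSpine-goR sp p p-spine)
    InΓ-goR⇒ p minus (inj₂ (p-off , i , i-leaf , (c , ch , c⪯i) , e)) =
      inj₂ (p-off ∘ OnSpine-goR⁻ sp p , goR i , i-leaf , (goR c , ch-inR ch , ⪯-R c⪯i) , e)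
    InΓ-goR⇒ p plus (p-off , i , i-leaf , (c , ch , c⪯i) , e) =
      p-off ∘ OnSpine-goR⁻ sp p , goR i , i-leaf , (goR c , ch-inR ch , ⪯-R c⪯i) , e

    InΓ-goR⇐ : ∀ p s → InΓ sp (node l r) a b (goR p) s → InΓ sp r (aR a b) (bR a b) p s
    InΓ-goR⇐ p minus (inj₁ p-spine) = inj₁ (OnSpine-goR⁻ sp p p-spine)
    InΓ-goR⇐ p minus (inj₂ (p-off , .(goR _) , i-leaf , (.(goR _) , ch-inR ch , ⪯-R c⪯i) , e)) =
      inj₂ (p-off ∘ OnSpine-goR sp p , _ , i-leaf , (_ , ch , c⪯i) , e)
    InΓ-goR⇐ p plus (p-off , .(goR _) , i-leaf , (.(goR _) , ch-inR ch , ⪯-R c⪯i) , e) =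
      p-off ∘ OnSpine-goR sp p , _ , i-leaf , (_ , ch , c⪯i) , e

    Avoids-goL⇒ : ∀ i L → Avoids sp (node l r) a b (goL i) (goL L) → Avoids false l (aL a b) (bL a b) i L
    Avoids-goL⇒ i L avoids p c s ch L⪯p c⪯i γ =
      avoids (goL p) (goL c) s (ch-inL ch) (⪯-L L⪯p) (⪯-L c⪯i) (InΓ-goL⇒ p s γ)

    Avoids-goL⇐ : ∀ i L → Avoids false l (aL a b) (bL a b) i L → Avoids sp (node l r) a b (goL i) (goL L)
    Avoids-goL⇐ i L avoids .(goL _) .(goL _) s (ch-inL ch) (⪯-L L⪯p) (⪯-L c⪯i) γ =
      avoids _ _ s ch L⪯p c⪯i (InΓ-goL⇐ _ s γ)

    Avoids-goR⇒ : ∀ i L → Avoids sp (node l r) a b (goR i) (goR L) → Avoids sp r (aR a b) (bR a b) i L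
    Avoids-goR⇒ i L avoids p c s ch L⪯p c⪯i γ =
      avoids (goR p) (goR c) s (ch-inR ch) (⪯-R L⪯p) (⪯-R c⪯i) (InΓ-goR⇒ p s γ)

    Avoids-goR⇐ : ∀ i L → Avoids sp r (aR a b) (bR a b) i L → Avoids sp (node l r) a b (goR i) (goR L)
    Avoids-goR⇐ i L avoids .(goR _) .(goR _) s (ch-inR ch) (⪯-R L⪯p) (⪯-R c⪯i) γ =
      avoids _ _ s ch L⪯p c⪯i (InΓ-goR⇐ _ s γ)

    Avoids-root-goL⇒ : ∀ i → Avoids sp (node l r) a b (goL i) here →
      ¬ InΓ sp (node l r) a b here minus × Avoids false l (aL a b) (bL a b) i here
    Avoids-root-goL⇒ i avoids =
      avoids here (goL here) minus ch-L ⪯-here (⪯-L ⪯-here) ,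
      Avoids-goL⇒ i here (λ p c s ch _ → avoids p c s ch ⪯-here)

    Avoids-root-goL⇐ : ∀ i → ¬ InΓ sp (node l r) a b here minus →
      Avoids false l (aL a b) (bL a b) i here → Avoids sp (node l r) a b (goL i) here
    Avoids-root-goL⇐ i root-edge avoids .here .(goL here) .minus ch-L _ _ = root-edge
    Avoids-root-goL⇐ i root-edge avoids .(goL _) .(goL _) s (ch-inL ch) _ =
      Avoids-goL⇐ i here avoids _ _ s (ch-inL ch) (⪯-L ⪯-here)

    Avoids-root-goR⇒ : ∀ i → Avoids sp (node l r) a b (goR i) here →
      ¬ InΓ sp (node l r) a b here plus × Avoids sp r (aR a b) (bR a b) i here
    Avoids-root-goR⇒ i avoids =
      avoids here (goR here) plus ch-R ⪯-here (⪯-R ⪯-here) ,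
      Avoids-goR⇒ i here (λ p c s ch _ → avoids p c s ch ⪯-here)

    Avoids-root-goR⇐ : ∀ i → ¬ InΓ sp (node l r) a b here plus →
      Avoids sp r (aR a b) (bR a b) i here → Avoids sp (node l r) a b (goR i) here
    Avoids-root-goR⇐ i root-edge avoids .here .(goR here) .plus ch-R _ _ = root-edge
    Avoids-root-goR⇐ i root-edge avoids .(goR _) .(goR _) s (ch-inR ch) _ =
      Avoids-goR⇐ i here avoids _ _ s (ch-inR ch) (⪯-R ⪯-here)

    IsPotential-goL : ∀ L ν → IsPotential sp (node l r) a b (goL L) ν →
                      IsPotential false l (aL a b) (bL a b) L (λ p → ν (goL p))
    IsPotential-goL L ν pot j j-leaf L⪯j = ≡.trans
      (∑-cong (leavesUnder L) (λ q → cong (_* ν (goL q)) (≡.sym (Ũ-goL a b sp q j))))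
      (≡.trans (≡.sym (∑-leavesUnder-goL L _)) (pot (goL j) j-leaf (⪯-L L⪯j)))

    IsPotential-goR : ∀ L ν → IsPotential sp (node l r) a b (goR L) ν →
                      IsPotential sp r (aR a b) (bR a b) L (λ p → ν (goR p))
    IsPotential-goR L ν pot j j-leaf L⪯j = ≡.trans
      (∑-cong (leavesUnder L) (λ q → cong (_* ν (goR q)) (≡.sym (Ũ-goR a b sp q j))))
      (≡.trans (≡.sym (∑-leavesUnder-goR L _)) (pot (goR j) j-leaf (⪯-R L⪯j)))

  ConstantBetween : ∀ {S} → (Pos S → ℝ) → (Pos S → ℝ) → Pos S → Pos S → ℝ → Set
  ConstantBetween a b M i v = ∀ q → M ⪯ q → q ⪯ i → a q ≡ v × b q ≡ v

  column-of-constant-path : ∀ S a b (i : Pos S) v → IsLeaf i → ConstantBetween a b here i v →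
                            ∀ k → IsLeaf k → Ũ false S a b k i ≡ v
  column-of-constant-path S a b i v i-leaf const k k-leaf with cmp k i in cmp≡
  ... | eq rewrite cmp≡eq⇒≡ k i cmp≡ = proj₁ (const i ⪯-here ⪯-refl)
  ... | lt = proj₁ (const (meet k i) ⪯-here (meet-⪯ʳ k i))
  ... | gt = proj₂ (const (meet k i) ⪯-here (meet-⪯ʳ k i))
  ... | anc = ⊥-elim (cmp≡anc⇒¬leaf k i cmp≡ k-leaf)
  ... | desc = ⊥-elim (cmp≡desc⇒¬leaf k i cmp≡ i-leaf)

  last-column : ∀ S a b k → IsLeaf k → Ũ true S a b k (last S) ≡ a (meet k (last S))
  last-column S a b k k-leaf with cmp k (last S) in cmp≡
  ... | eq rewrite cmp≡eq⇒≡ k (last S) cmp≡ = cong a (≡.sym (meet-idem (last S)))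
  ... | lt = ≡.refl
  ... | gt = ⊥-elim (cmp-last≢gt k cmp≡)
  ... | anc = ⊥-elim (cmp≡anc⇒¬leaf k (last S) cmp≡ k-leaf)
  ... | desc = ⊥-elim (cmp≡desc⇒¬leaf k (last S) cmp≡ (last-isLeaf S))

  module _ {l r : Tree} {a b : Pos (node l r) → ℝ} {v : ℝ} where
    ConstantBetween-goL : ∀ {i} → ConstantBetween a b here (goL i) v → ConstantBetween (aL a b) (bL a b) here i v
    ConstantBetween-goL const q _ q⪯i = const (goL q) ⪯-here (⪯-L q⪯i)

    ConstantBetween-goR : ∀ {i} → ConstantBetween a b here (goR i) v → ConstantBetween (aR a b) (bR a b) here i v
    ConstantBetween-goR const q _ q⪯i = const (goR q) ⪯-here (⪯-R q⪯i)

    ConstantBetween-goL⁻ : ∀ {M i} → ConstantBetween a b (goL M) (goL i) v → ConstantBetween (aL a b) (bL a b) M i v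
    ConstantBetween-goL⁻ const q M⪯q q⪯i = const (goL q) (⪯-L M⪯q) (⪯-L q⪯i)

    ConstantBetween-goR⁻ : ∀ {M i} → ConstantBetween a b (goR M) (goR i) v → ConstantBetween (aR a b) (bR a b) M i v
    ConstantBetween-goR⁻ const q M⪯q q⪯i = const (goR q) (⪯-R M⪯q) (⪯-R q⪯i)

  spine-tie⇒same-column-as-last :
    ∀ S a b (M c i : Pos S) v → (∀ q → OnSpine true S q → a q ≡ b q) → M ⪯ last S → ChildOf M c minus →
    c ⪯ i → IsLeaf i → ConstantBetween a b M i v →
    ∀ k → IsLeaf k → Ũ true S a b k i ≡ Ũ true S a b k (last S)
  spine-tie⇒same-column-as-last (node l r) a b here _ (goL i) v _ _ ch-L _ i-leaf const (goL k) k-leaf = begin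
    Ũ true (node l r) a b (goL k) (goL i)   ≡⟨ Ũ-goL a b true k i ⟩
    Ũ false l (aL a b) (bL a b) k i         ≡⟨ column-of-constant-path l _ _ i v i-leaf (ConstantBetween-goL const) k k-leaf ⟩
    v                                       ≡⟨ ≡.sym (proj₁ (const here ⪯-here ⪯-here)) ⟩
    a here                                  ∎
    where open ≡.≡-Reasoning
  spine-tie⇒same-column-as-last (node l r) a b here _ (goL i) v spine-eq _ ch-L _ _ _ (goR k) k-leaf = begin
    b (goR (meet k (last r)))               ≡⟨ ≡.sym (spine-eq (goR (meet k (last r))) (⪯-R (meet-⪯ʳ k (last r)))) ⟩
    a (goR (meet k (last r)))               ≡⟨ ≡.sym (last-column r _ _ k k-leaf) ⟩
    Ũ true r (aR a b) (bR a b) k (last r)   ≡⟨ ≡.sym (Ũ-goR a b true k (last r)) ⟩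
    Ũ true (node l r) a b (goR k) (goR (last r)) ∎
    where open ≡.≡-Reasoning
  spine-tie⇒same-column-as-last (node l r) a b (goR M) (goR c) (goR i) v spine-eq
                                (⪯-R M⪯last) (ch-inR ch) (⪯-R c⪯i) i-leaf const (goL k) k-leaf = ≡.refl
  spine-tie⇒same-column-as-last (node l r) a b (goR M) (goR c) (goR i) v spine-eq
                                (⪯-R M⪯last) (ch-inR ch) (⪯-R c⪯i) i-leaf const (goR k) k-leaf = begin
    Ũ true (node l r) a b (goR k) (goR i)          ≡⟨ Ũ-goR a b true k i ⟩
    Ũ true r (aR a b) (bR a b) k i                 ≡⟨ spine-tie⇒same-column-as-last r _ _ M c i v
                                                        (λ q q-spine → spine-eq (goR q) (⪯-R q-spine)) M⪯last ch c⪯i i-leaf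
                                                        (ConstantBetween-goR⁻ const) k k-leaf ⟩
    Ũ true r (aR a b) (bR a b) k (last r)          ≡⟨ ≡.sym (Ũ-goR a b true k (last r)) ⟩
    Ũ true (node l r) a b (goR k) (goR (last r))   ∎
    where open ≡.≡-Reasoning

  off-spine-tie⇒same-columns :
    ∀ sp S a b (M c₁ c₂ i j : Pos S) v → ¬ OnSpine sp S M → ChildOf M c₁ minus → ChildOf M c₂ plus →
    c₁ ⪯ i → c₂ ⪯ j → IsLeaf i → IsLeaf j → ConstantBetween a b M i v → ConstantBetween a b M j v →
    ∀ k → IsLeaf k → Ũ sp S a b k i ≡ Ũ sp S a b k j
  off-spine-tie⇒same-columns true (node l r) a b here _ _ _ _ _ M-off ch-L ch-R _ _ _ _ _ _ _ _ = ⊥-elim (M-off ⪯-here)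
  off-spine-tie⇒same-columns false (node l r) a b here _ _ (goL i) (goR j) v _ ch-L ch-R _ _
                             i-leaf _ const-i const-j (goL k) k-leaf = begin
    Ũ false (node l r) a b (goL k) (goL i)   ≡⟨ Ũ-goL a b false k i ⟩
    Ũ false l (aL a b) (bL a b) k i          ≡⟨ column-of-constant-path l _ _ i v i-leaf (ConstantBetween-goL const-i) k k-leaf ⟩
    v                                        ≡⟨ ≡.sym (proj₁ (const-j here ⪯-here ⪯-here)) ⟩
    a here                                   ∎
    where open ≡.≡-Reasoning
  off-spine-tie⇒same-columns false (node l r) a b here _ _ (goL i) (goR j) v _ ch-L ch-R _ _
                             _ j-leaf const-i const-j (goR k) k-leaf = begin
    b here                                   ≡⟨ proj₂ (const-i here ⪯-here ⪯-here) ⟩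
    v                                        ≡⟨ ≡.sym (column-of-constant-path r _ _ j v j-leaf (ConstantBetween-goR const-j) k k-leaf) ⟩
    Ũ false r (aR a b) (bR a b) k j          ≡⟨ ≡.sym (Ũ-goR a b false k j) ⟩
    Ũ false (node l r) a b (goR k) (goR j)   ∎
    where open ≡.≡-Reasoning
  off-spine-tie⇒same-columns sp (node l r) a b (goL M) (goL c₁) (goL c₂) (goL i) (goL j) v _ (ch-inL ch₁) (ch-inL ch₂)
                             (⪯-L c₁⪯i) (⪯-L c₂⪯j) i-leaf j-leaf const-i const-j (goL k) k-leaf = begin
    Ũ sp (node l r) a b (goL k) (goL i)      ≡⟨ Ũ-goL a b sp k i ⟩
    Ũ false l (aL a b) (bL a b) k i          ≡⟨ off-spine-tie⇒same-columns false l _ _ M c₁ c₂ i j v (λ ()) ch₁ ch₂ c₁⪯i c₂⪯j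
                                                  i-leaf j-leaf (ConstantBetween-goL⁻ const-i) (ConstantBetween-goL⁻ const-j) k k-leaf ⟩
    Ũ false l (aL a b) (bL a b) k j          ≡⟨ ≡.sym (Ũ-goL a b sp k j) ⟩
    Ũ sp (node l r) a b (goL k) (goL j)      ∎
    where open ≡.≡-Reasoning
  off-spine-tie⇒same-columns sp (node l r) a b (goL M) (goL c₁) (goL c₂) (goL i) (goL j) _ _ (ch-inL _) (ch-inL _)
                             _ _ _ _ _ _ (goR k) _ = row-constant-on-left sp
    where
    row-constant-on-left : ∀ sp → Ũ sp (node l r) a b (goR k) (goL i) ≡ Ũ sp (node l r) a b (goR k) (goL j)
    row-constant-on-left true = ≡.refl
    row-constant-on-left false = ≡.refl
  off-spine-tie⇒same-columns sp (node l r) a b (goR M) (goR c₁) (goR c₂) (goR i) (goR j) _ _ (ch-inR _) (ch-inR _)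
                             _ _ _ _ _ _ (goL k) _ = ≡.refl
  off-spine-tie⇒same-columns sp (node l r) a b (goR M) (goR c₁) (goR c₂) (goR i) (goR j) v M-off (ch-inR ch₁) (ch-inR ch₂)
                             (⪯-R c₁⪯i) (⪯-R c₂⪯j) i-leaf j-leaf const-i const-j (goR k) k-leaf = begin
    Ũ sp (node l r) a b (goR k) (goR i)      ≡⟨ Ũ-goR a b sp k i ⟩
    Ũ sp r (aR a b) (bR a b) k i             ≡⟨ off-spine-tie⇒same-columns sp r _ _ M c₁ c₂ i j v (M-off ∘ OnSpine-goR sp M) ch₁ ch₂
                                                  c₁⪯i c₂⪯j i-leaf j-leaf (ConstantBetween-goR⁻ const-i) (ConstantBetween-goR⁻ const-j)
                                                  k k-leaf ⟩
    Ũ sp r (aR a b) (bR a b) k j             ≡⟨ ≡.sym (Ũ-goR a b sp k j) ⟩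
    Ũ sp (node l r) a b (goR k) (goR j)      ∎
    where open ≡.≡-Reasoning

module NonDegeneracy (F : RealField) (T : Tree) (α β : Pos T → RealField.ℝ F)
                     (U-data : IsUData F T α β) (U-nonsingular : Nonsingular F T (Umat F T α β)) where
  open OrderedField F
  open LocalMatrix F
  open Nonsingularity F
  open IsUData U-data

  private
    distinct-Ũ-columns : ∀ i j → IsLeaf i → IsLeaf j → i ≢ j →
                         ¬ (∀ k → IsLeaf k → Ũ true T α β k i ≡ Ũ true T α β k j)
    distinct-Ũ-columns i j i-leaf j-leaf i≢j same = distinct-columns U-nonsingular i j i-leaf j-leaf i≢j
      (λ k k-leaf → ≡.trans (Umat≡Ũ T α β k i) (≡.trans (same k k-leaf) (≡.sym (Umat≡Ũ T α β k j))))

    constant-between : ∀ p i → β i ≡ α p → ConstantBetween α β p i (α p)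
    constant-between p i βi≡αp q p⪯q q⪯i =
      ≤-antisym (≤-trans (α≤β q) (≤-trans (β-mono q i q⪯i) (inj₂ βi≡αp))) (α-mono p q p⪯q) ,
      ≤-antisym (≤-trans (β-mono q i q⪯i) (inj₂ βi≡αp)) (≤-trans (α-mono p q p⪯q) (α≤β q))

  no-tie-on-spine : ∀ p c i → OnSpine true T p → ChildOf p c minus → c ⪯ i → IsLeaf i → β i ≢ α p
  no-tie-on-spine p c i p-spine ch c⪯i i-leaf βi≡αp =
    distinct-Ũ-columns i (last T) i-leaf (last-isLeaf T) (λ i≡last → minus-child-off-spine ch (subst (c ⪯_) i≡last c⪯i))
      (spine-tie⇒same-column-as-last T α β p c i (α p) spine-eq p-spine ch c⪯i i-leaf (constant-between p i βi≡αp))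

  no-tie-off-spine : ∀ p c₁ c₂ i j → ¬ OnSpine true T p → ChildOf p c₁ minus → ChildOf p c₂ plus →
                     c₁ ⪯ i → c₂ ⪯ j → IsLeaf i → IsLeaf j → β i ≡ α p → β j ≢ α p
  no-tie-off-spine p c₁ c₂ i j p-off ch₁ ch₂ c₁⪯i c₂⪯j i-leaf j-leaf βi≡αp βj≡αp =
    distinct-Ũ-columns i j i-leaf j-leaf (below-distinct-children ch₁ ch₂ c₁⪯i c₂⪯j)
      (off-spine-tie⇒same-columns true T α β p c₁ c₂ i j (α p) p-off ch₁ ch₂ c₁⪯i c₂⪯j i-leaf j-leaf
        (constant-between p i βi≡αp) (constant-between p j βj≡αp))

  leaf-nonzero : ∀ i → IsLeaf i → α i ≢ 0r
  leaf-nonzero i i-leaf αi≡0 with leaf-last-or-off-spine i i-leaf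
  ... | inj₁ ≡.refl = nonzero-column U-nonsingular (last T) (last-isLeaf T) λ k k-leaf →
        ≡.trans (Umat≡Ũ T α β k (last T)) (≡.trans (last-column T α β k k-leaf)
          (≤-antisym (≤-trans (α-mono _ _ (meet-⪯ʳ k (last T))) (inj₂ αi≡0)) (α-nonneg _)))
  ... | inj₂ (M , c , M-spine , ch , c⪯i) = no-tie-on-spine M c i M-spine ch c⪯i i-leaf
        (≡.trans (≡.sym (leaf-eq i i-leaf)) (≡.trans αi≡0 (≡.sym αM≡0)))
    where
    αM≡0 : α M ≡ 0r
    αM≡0 = ≤-antisym (≤-trans (α-mono M i (⪯-trans (ChildOf⇒⪯ ch) c⪯i)) (inj₂ αi≡0)) (α-nonneg M)

  admissible : Admissible true T α β
  admissible = record
    { a-nonneg = α-nonneg ; a≤b = α≤β ; leaf-eq = leaf-eq ; a-mono = α-mono ; b-mono = β-mono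
    ; spine-eq = spine-eq ; leaf-nonzero = leaf-nonzero
    ; no-tie-on-spine = no-tie-on-spine ; no-tie-off-spine = no-tie-off-spine }

module Recursion (F : RealField) where
  open OrderedField F
  open FiniteSums F
  open LocalMatrix F

  AttainedAtLeaf : (S : Tree) → (Pos S → ℝ) → ℝ → Set
  AttainedAtLeaf S f v = ∃ λ i → IsLeaf i × f i ≡ v

  record LevelBound (S : Tree) (b : Pos S → ℝ) (γ s : ℝ) : Set where
    field
      bound : γ * s ≤ 1r
      tight⇒attained : γ * s ≡ 1r → AttainedAtLeaf S b γ
      attained⇒tight : AttainedAtLeaf S b γ → γ * s ≡ 1r

  MassBound : (S : Tree) → (Pos S → ℝ) → ℝ → Set
  MassBound S b s = 0r < s × LevelBound S b (b here) s

  RootInvariant : (sp : Bool) (S : Tree) → (Pos S → ℝ) → (Pos S → ℝ) → Set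
  RootInvariant true S b ν = ∀ i → IsLeaf i → (0r < ν i → i ≡ last S) × (i ≡ last S → 0r < ν i)
  RootInvariant false S b ν = MassBound S b (∑[ leaves S ] ν)

  -- ν is pinned down by `unique`.
  record RootPotential (sp : Bool) (S : Tree) (a b : Pos S → ℝ) : Set where
    field
      ν : Pos S → ℝ
      unique : ∀ x c → IsSolutionᵗ sp S a b x c → ∀ i → IsLeaf i → x i ≡ c * ν i
      positive⇒avoids : ∀ i → IsLeaf i → 0r < ν i → Avoids sp S a b i here
      avoids⇒positive : ∀ i → IsLeaf i → Avoids sp S a b i here → 0r < ν i
      root-invariant : RootInvariant sp S b ν

  MassBound-scale : ∀ {S} {b : Pos S → ℝ} {s} γ → MassBound S b s → (∀ i → b here ≤ b i) → γ ≤ b here →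
                    LevelBound S b γ s
  MassBound-scale {S} {b} {s} γ (0<s , root-bound) b-min γ≤b = record
    { bound = ≤-trans γs≤bs bound
    ; tight⇒attained = tight⇒attained′
    ; attained⇒tight = attained⇒tight′
    }
    where
    open LevelBound root-bound
    γs≤bs : γ * s ≤ b here * s
    γs≤bs = *-monoˡ-≤-nonneg s (inj₁ 0<s) γ≤b
    tight⇒attained′ : γ * s ≡ 1r → AttainedAtLeaf S b γ
    tight⇒attained′ γs≡1 = subst (AttainedAtLeaf S b) (≡.sym γ≡b) (tight⇒attained bs≡1)
      where
      bs≡1 : b here * s ≡ 1r
      bs≡1 = ≤-antisym bound (subst (_≤ b here * s) γs≡1 γs≤bs)
      γ≡b : γ ≡ b here
      γ≡b = *-cancelʳ-pos 0<s (≡.trans γs≡1 (≡.sym bs≡1))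
    attained⇒tight′ : AttainedAtLeaf S b γ → γ * s ≡ 1r
    attained⇒tight′ (i , i-leaf , bi≡γ) =
      subst (λ x → x * s ≡ 1r) (≡.sym γ≡b) (attained⇒tight (i , i-leaf , ≡.trans bi≡γ γ≡b))
      where
      γ≡b : γ ≡ b here
      γ≡b = ≤-antisym γ≤b (subst (b here ≤_) bi≡γ (b-min i))

  leaf-potential : ∀ sp a b → Admissible sp leaf a b → RootPotential sp leaf a b
  leaf-potential sp a b adm = record
    { ν = λ _ → a⁻¹
    ; unique = unique
    ; positive⇒avoids = λ _ _ _ _ _ _ ()
    ; avoids⇒positive = λ _ _ _ → 0<a⁻¹
    ; root-invariant = root-invariant sp
    }
    where
    open Admissible adm
    0<a : 0r < a here
    0<a = 0≤x∧x≢0⇒0<x (a-nonneg here) (leaf-nonzero here ≡.refl)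
    a⁻¹ : ℝ
    a⁻¹ = proj₁ (inverse-pos (a here) 0<a)
    0<a⁻¹ : 0r < a⁻¹
    0<a⁻¹ = proj₁ (proj₂ (inverse-pos (a here) 0<a))
    aa⁻¹≡1 : a here * a⁻¹ ≡ 1r
    aa⁻¹≡1 = proj₂ (proj₂ (inverse-pos (a here) 0<a))
    unique : ∀ x c → IsSolutionᵗ sp leaf a b x c → ∀ i → IsLeaf i → x i ≡ c * a⁻¹
    unique x c solution here _ = begin
      x here                       ≡⟨ ≡.sym (*-identityˡ _) ⟩
      1r * x here                  ≡⟨ cong (_* x here) (≡.sym aa⁻¹≡1) ⟩
      (a here * a⁻¹) * x here      ≡⟨ solve 3 (λ a x y → (a :* y) :* x := y :* (a :* x :+ con (ℤ.+ 0)))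
                                             ≡.refl (a here) (x here) a⁻¹ ⟩
      a⁻¹ * (a here * x here + 0r) ≡⟨ cong (a⁻¹ *_) (solution here ≡.refl) ⟩
      a⁻¹ * c                      ≡⟨ *-comm a⁻¹ c ⟩
      c * a⁻¹                      ∎
      where open ≡.≡-Reasoning
    root-invariant : ∀ sp → RootInvariant sp leaf b (λ _ → a⁻¹)
    root-invariant true here _ = (λ _ → ≡.refl) , (λ _ → 0<a⁻¹)
    root-invariant false = subst (0r <_) (≡.sym (+-identityʳ a⁻¹)) 0<a⁻¹ , record
      { bound = inj₂ b[a⁻¹+0]≡1
      ; tight⇒attained = λ _ → here , ≡.refl , ≡.refl
      ; attained⇒tight = λ _ → b[a⁻¹+0]≡1
      }
      where
      b[a⁻¹+0]≡1 : b here * (a⁻¹ + 0r) ≡ 1r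
      b[a⁻¹+0]≡1 = ≡.trans (cong₂ _*_ (≡.sym (leaf-eq here ≡.refl)) (+-identityʳ a⁻¹)) aa⁻¹≡1

  module _ {l r : Tree} (a b : Pos (node l r) → ℝ) (x : Pos (node l r) → ℝ) (c : ℝ) where
    open ≡.≡-Reasoning

    solution-goR : ∀ sp → IsSolutionᵗ sp (node l r) a b x c →
      IsSolutionᵗ sp r (aR a b) (bR a b) (λ p → x (goR p)) (c - a here * ∑[ leaves l ] (λ p → x (goL p)))
    solution-goR sp solution j j-leaf = x+y≡z⇒x≡z-y (begin
      ∑[ leaves r ] (λ i → Ũ sp r (aR a b) (bR a b) i j * x (goR i)) + a here * ∑[ leaves l ] (λ p → x (goL p))
        ≡⟨ +-comm _ _ ⟩
      a here * ∑[ leaves l ] (λ p → x (goL p)) + ∑[ leaves r ] (λ i → Ũ sp r (aR a b) (bR a b) i j * x (goR i))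
        ≡⟨ cong₂ _+_ (≡.sym (∑-*ˡ (a here) _ (leaves l)))
                     (∑-cong (leaves r) (λ i → cong (_* x (goR i)) (≡.sym (Ũ-goR a b sp i j)))) ⟩
      ∑[ leaves l ] (λ i → a here * x (goL i)) + ∑[ leaves r ] (λ i → Ũ sp (node l r) a b (goR i) (goR j) * x (goR i))
        ≡⟨ ≡.sym (∑-node l r _) ⟩
      ∑[ leaves (node l r) ] (λ i → Ũ sp (node l r) a b i (goR j) * x i)
        ≡⟨ solution (goR j) j-leaf ⟩
      c ∎)

    solution-goL-off-spine : IsSolutionᵗ false (node l r) a b x c →
      IsSolutionᵗ false l (aL a b) (bL a b) (λ p → x (goL p)) (c - b here * ∑[ leaves r ] (λ p → x (goR p)))
    solution-goL-off-spine solution j j-leaf = x+y≡z⇒x≡z-y (begin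
      ∑[ leaves l ] (λ i → Ũ false l (aL a b) (bL a b) i j * x (goL i)) + b here * ∑[ leaves r ] (λ p → x (goR p))
        ≡⟨ cong₂ _+_ (∑-cong (leaves l) (λ i → cong (_* x (goL i)) (≡.sym (Ũ-goL a b false i j))))
                     (≡.sym (∑-*ˡ (b here) _ (leaves r))) ⟩
      ∑[ leaves l ] (λ i → Ũ false (node l r) a b (goL i) (goL j) * x (goL i)) + ∑[ leaves r ] (λ i → b here * x (goR i))
        ≡⟨ ≡.sym (∑-node l r _) ⟩
      ∑[ leaves (node l r) ] (λ i → Ũ false (node l r) a b i (goL j) * x i)
        ≡⟨ solution (goL j) j-leaf ⟩
      c ∎)

  1-β[k₁A+k₂B]-identity : ∀ α β A B d →
    (1r - (β * B) * (α * A)) * d - β * ((1r - β * B) * d * A + (1r - α * A) * d * B)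
      ≡ ((1r - β * A) * (1r - β * B)) * d
  1-β[k₁A+k₂B]-identity = solve 5 (λ α β A B d →
    (con 1ℤ :- (β :* B) :* (α :* A)) :* d :- β :* ((con 1ℤ :- β :* B) :* d :* A :+ (con 1ℤ :- α :* A) :* d :* B)
      := ((con 1ℤ :- β :* A) :* (con 1ℤ :- β :* B)) :* d) ≡.refl

  k₁A+k₂B-identity : ∀ α β A B d →
    (1r - β * B) * d * A + (1r - α * A) * d * B ≡ ((1r - β * B) * A + (1r - α * A) * B) * d
  k₁A+k₂B-identity = solve 5 (λ α β A B d →
    (con 1ℤ :- β :* B) :* d :* A :+ (con 1ℤ :- α :* A) :* d :* B
      := ((con 1ℤ :- β :* B) :* A :+ (con 1ℤ :- α :* A) :* B) :* d) ≡.refl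

  glue : ∀ {l r} → (Pos l → ℝ) → (Pos r → ℝ) → Pos (node l r) → ℝ
  glue f g here = 0r
  glue f g (goL p) = f p
  glue f g (goR p) = g p

  module OffSpineNode {l r : Tree} {a b : Pos (node l r) → ℝ} (adm : Admissible false (node l r) a b)
                      (P₁ : RootPotential false l (aL a b) (bL a b))
                      (P₂ : RootPotential false r (aR a b) (bR a b)) where
    open Admissible adm
    module P₁ = RootPotential P₁
    module P₂ = RootPotential P₂
    open ≡.≡-Reasoning

    α β A B u v : ℝ
    α = a here
    β = b here
    A = ∑[ leaves l ] P₁.ν
    B = ∑[ leaves r ] P₂.ν
    u = α * A
    v = β * B

    0<A : 0r < A
    0<A = proj₁ P₁.root-invariant
    0<B : 0r < B
    0<B = proj₁ P₂.root-invariant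

    αA-bound : LevelBound l (bL a b) α A
    αA-bound = MassBound-scale α P₁.root-invariant (λ i → b-mono (goL here) (goL i) (⪯-L ⪯-here))
                                (≤-trans (a-mono here (goL here) ⪯-here) (a≤b (goL here)))
    βB-bound : LevelBound r (bR a b) β B
    βB-bound = MassBound-scale β P₂.root-invariant (λ i → b-mono (goR here) (goR i) (⪯-R ⪯-here)) (b-mono here (goR here) ⪯-here)
    βA-bound : LevelBound l (bL a b) β A
    βA-bound = MassBound-scale β P₁.root-invariant (λ i → b-mono (goL here) (goL i) (⪯-L ⪯-here)) (b-mono here (goL here) ⪯-here)
    module αA = LevelBound αA-bound
    module βB = LevelBound βB-bound
    module βA = LevelBound βA-bound

    0≤u : 0r ≤ u
    0≤u = *-nonneg (a-nonneg here) (inj₁ 0<A)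
    0≤v : 0r ≤ v
    0≤v = *-nonneg (≤-trans (a-nonneg here) (a≤b here)) (inj₁ 0<B)

    not-both-tight : u ≡ 1r → v ≢ 1r
    not-both-tight u≡1 v≡1 = ties-below-both-children (αA.tight⇒attained u≡1) (βB.tight⇒attained v≡1)
      where
      ties-below-both-children : AttainedAtLeaf l (bL a b) α → ¬ AttainedAtLeaf r (bR a b) β
      ties-below-both-children (i , i-leaf , bi≡α) (j , j-leaf , bj≡β) =
        no-tie-off-spine here (goL here) (goR here) (goL i) (goR j) (λ ()) ch-L ch-R (⪯-L ⪯-here) (⪯-R ⪯-here)
          i-leaf j-leaf bi≡α (≡.trans bj≡β β≡α)
        where
        β≡α : β ≡ α
        β≡α = ≤-antisym (subst (β ≤_) bi≡α (b-mono here (goL i) ⪯-here)) (a≤b here)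

    D : ℝ
    D = 1r - v * u
    0<D : 0r < D
    0<D = x<y⇒0<y-x (≤∧≢⇒< (≤-trans (*-≤ˡ 0≤v αA.bound) βB.bound) vu≢1)
      where
      vu≢1 : v * u ≢ 1r
      vu≢1 vu≡1 = let v≡1 , u≡1 = *-≡1-unit-interval 0≤v βB.bound αA.bound vu≡1 in not-both-tight u≡1 v≡1

    D⁻¹ : ℝ
    D⁻¹ = proj₁ (inverse-pos D 0<D)
    0<D⁻¹ : 0r < D⁻¹
    0<D⁻¹ = proj₁ (proj₂ (inverse-pos D 0<D))
    DD⁻¹≡1 : D * D⁻¹ ≡ 1r
    DD⁻¹≡1 = proj₂ (proj₂ (inverse-pos D 0<D))

    k₁ k₂ : ℝ
    k₁ = (1r - v) * D⁻¹
    k₂ = (1r - u) * D⁻¹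

    ν : Pos (node l r) → ℝ
    ν = glue (λ p → k₁ * P₁.ν p) (λ p → k₂ * P₂.ν p)

    unique : ∀ x c → IsSolutionᵗ false (node l r) a b x c → ∀ i → IsLeaf i → x i ≡ c * ν i
    unique x c solution = x≡cν
      where
      Sx Sy c₁ c₂ : ℝ
      Sx = ∑[ leaves l ] (λ p → x (goL p))
      Sy = ∑[ leaves r ] (λ p → x (goR p))
      c₁ = c - β * Sy
      c₂ = c - α * Sx
      x₁≡c₁ν₁ : ∀ i → IsLeaf i → x (goL i) ≡ c₁ * P₁.ν i
      x₁≡c₁ν₁ = P₁.unique _ c₁ (solution-goL-off-spine a b x c solution)
      x₂≡c₂ν₂ : ∀ i → IsLeaf i → x (goR i) ≡ c₂ * P₂.ν i
      x₂≡c₂ν₂ = P₂.unique _ c₂ (solution-goR a b x c false solution)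
      c-shift : ∀ γ S κ M → S ≡ κ * M → c - γ * S ≡ c - (γ * M) * κ
      c-shift γ S κ M S≡κM = ≡.trans (cong (λ t → c - γ * t) S≡κM)
        (solve 4 (λ c γ κ M → c :- γ :* (κ :* M) := c :- (γ :* M) :* κ) ≡.refl c γ κ M)
      c₁≡ : c₁ ≡ c - v * c₂
      c₁≡ = c-shift β Sy c₂ B (≡.trans (∑-leaves-cong r x₂≡c₂ν₂) (∑-*ˡ c₂ P₂.ν (leaves r)))
      c₂≡ : c₂ ≡ c - u * c₁
      c₂≡ = c-shift α Sx c₁ A (≡.trans (∑-leaves-cong l x₁≡c₁ν₁) (∑-*ˡ c₁ P₁.ν (leaves l)))
      cramer : c₁ ≡ c * k₁ × c₂ ≡ c * k₂
      cramer = cramer₂ c₁≡ c₂≡ DD⁻¹≡1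
      x≡cν : ∀ i → IsLeaf i → x i ≡ c * ν i
      x≡cν (goL i) i-leaf = ≡.trans (x₁≡c₁ν₁ i i-leaf) (≡.trans (cong (_* P₁.ν i) (proj₁ cramer)) (*-assoc c k₁ (P₁.ν i)))
      x≡cν (goR i) i-leaf = ≡.trans (x₂≡c₂ν₂ i i-leaf) (≡.trans (cong (_* P₂.ν i) (proj₂ cramer)) (*-assoc c k₂ (P₂.ν i)))

    InΓ-root-minus⇒tight : InΓ false (node l r) a b here minus → v ≡ 1r
    InΓ-root-minus⇒tight (inj₂ (_ , .(goR _) , i-leaf , (.(goR here) , ch-R , ⪯-R _) , β≡bi)) =
      βB.attained⇒tight (_ , i-leaf , ≡.sym β≡bi)

    tight⇒InΓ-root-minus : v ≡ 1r → InΓ false (node l r) a b here minus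
    tight⇒InΓ-root-minus v≡1 = edge (βB.tight⇒attained v≡1)
      where
      edge : AttainedAtLeaf r (bR a b) β → InΓ false (node l r) a b here minus
      edge (i , i-leaf , bi≡β) = inj₂ ((λ ()) , goR i , i-leaf , (goR here , ch-R , ⪯-R ⪯-here) , ≡.sym bi≡β)

    InΓ-root-plus⇒tight : InΓ false (node l r) a b here plus → u ≡ 1r
    InΓ-root-plus⇒tight (_ , .(goL _) , i-leaf , (.(goL here) , ch-L , ⪯-L _) , α≡ai) =
      αA.attained⇒tight (_ , i-leaf , ≡.trans (≡.sym (leaf-eq (goL _) i-leaf)) (≡.sym α≡ai))

    tight⇒InΓ-root-plus : u ≡ 1r → InΓ false (node l r) a b here plus
    tight⇒InΓ-root-plus u≡1 = edge (αA.tight⇒attained u≡1)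
      where
      edge : AttainedAtLeaf l (bL a b) α → InΓ false (node l r) a b here plus
      edge (i , i-leaf , bi≡α) = (λ ()) , goL i , i-leaf , (goL here , ch-L , ⪯-L ⪯-here) ,
                                 ≡.sym (≡.trans (leaf-eq (goL i) i-leaf) bi≡α)

    0<[1-z]D⁻¹ : ∀ {z} → z ≤ 1r → z ≢ 1r → 0r < (1r - z) * D⁻¹
    0<[1-z]D⁻¹ z≤1 z≢1 = *-pos (x<y⇒0<y-x (≤∧≢⇒< z≤1 z≢1)) 0<D⁻¹

    0<[1-z]D⁻¹y : ∀ {z y} → z ≤ 1r → 0r < (1r - z) * D⁻¹ * y → z ≢ 1r × 0r < y
    0<[1-z]D⁻¹y {z} {y} z≤1 0<kzy = z≢1 , *-cancelˡ-pos (0<[1-z]D⁻¹ z≤1 z≢1) 0<kzy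
      where
      z≢1 : z ≢ 1r
      z≢1 z≡1 = <⇒≢ 0<kzy (≡.sym (begin
        (1r - z) * D⁻¹ * y   ≡⟨ cong (λ t → t * D⁻¹ * y) (x≡1⇒1-x≡0 z≡1) ⟩
        0r * D⁻¹ * y         ≡⟨ ≡.trans (cong (_* y) (zeroˡ D⁻¹)) (zeroˡ y) ⟩
        0r                   ∎))

    positive⇒avoids : ∀ i → IsLeaf i → 0r < ν i → Avoids false (node l r) a b i here
    positive⇒avoids (goL i) i-leaf 0<νi =
      let v≢1 , 0<ν₁i = 0<[1-z]D⁻¹y βB.bound 0<νi in
      Avoids-root-goL⇐ i (v≢1 ∘ InΓ-root-minus⇒tight) (P₁.positive⇒avoids i i-leaf 0<ν₁i)
    positive⇒avoids (goR i) i-leaf 0<νi =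
      let u≢1 , 0<ν₂i = 0<[1-z]D⁻¹y αA.bound 0<νi in
      Avoids-root-goR⇐ i (u≢1 ∘ InΓ-root-plus⇒tight) (P₂.positive⇒avoids i i-leaf 0<ν₂i)

    avoids⇒positive : ∀ i → IsLeaf i → Avoids false (node l r) a b i here → 0r < ν i
    avoids⇒positive (goL i) i-leaf avoids =
      let root-edge , below = Avoids-root-goL⇒ i avoids in
      *-pos (0<[1-z]D⁻¹ βB.bound (root-edge ∘ tight⇒InΓ-root-minus)) (P₁.avoids⇒positive i i-leaf below)
    avoids⇒positive (goR i) i-leaf avoids =
      let root-edge , below = Avoids-root-goR⇒ i avoids in
      *-pos (0<[1-z]D⁻¹ αA.bound (root-edge ∘ tight⇒InΓ-root-plus)) (P₂.avoids⇒positive i i-leaf below)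

    s : ℝ
    s = ∑[ leaves (node l r) ] ν

    s≡k₁A+k₂B : s ≡ k₁ * A + k₂ * B
    s≡k₁A+k₂B = ≡.trans (∑-node l r ν) (cong₂ _+_ (∑-*ˡ k₁ P₁.ν (leaves l)) (∑-*ˡ k₂ P₂.ν (leaves r)))

    1-βs≡ : 1r - β * s ≡ ((1r - β * A) * (1r - v)) * D⁻¹
    1-βs≡ = begin
      1r - β * s
        ≡⟨ cong₂ (λ t t′ → t - β * t′) (≡.sym DD⁻¹≡1) s≡k₁A+k₂B ⟩
      D * D⁻¹ - β * (k₁ * A + k₂ * B)
        ≡⟨ 1-β[k₁A+k₂B]-identity α β A B D⁻¹ ⟩
      ((1r - β * A) * (1r - v)) * D⁻¹ ∎

    N : ℝ
    N = (1r - v) * A + (1r - u) * B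

    0<N : 0r < N
    0<N = 0≤x∧x≢0⇒0<x (+-nonneg 0≤[1-v]A 0≤[1-u]B) N≢0
      where
      0≤[1-v]A : 0r ≤ (1r - v) * A
      0≤[1-v]A = *-nonneg (x≤y⇒0≤y-x βB.bound) (inj₁ 0<A)
      0≤[1-u]B : 0r ≤ (1r - u) * B
      0≤[1-u]B = *-nonneg (x≤y⇒0≤y-x αA.bound) (inj₁ 0<B)
      N≢0 : N ≢ 0r
      N≢0 N≡0 = not-both-tight
        (1-x≡0⇒x≡1 (*-cancelʳ-zero 0<B (+-nonneg-zeroˡ 0≤[1-u]B 0≤[1-v]A (≡.trans (+-comm _ _) N≡0))))
        (1-x≡0⇒x≡1 (*-cancelʳ-zero 0<A (+-nonneg-zeroˡ 0≤[1-v]A 0≤[1-u]B N≡0)))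

    0<s : 0r < s
    0<s = subst (0r <_) (≡.sym s≡ND⁻¹) (*-pos 0<N 0<D⁻¹)
      where
      s≡ND⁻¹ : s ≡ N * D⁻¹
      s≡ND⁻¹ = ≡.trans s≡k₁A+k₂B (k₁A+k₂B-identity α β A B D⁻¹)

    βs-bound : LevelBound (node l r) b β s
    βs-bound = record
      { bound = 0≤y-x⇒x≤y (subst (0r ≤_) (≡.sym 1-βs≡)
          (*-nonneg (*-nonneg (x≤y⇒0≤y-x βA.bound) (x≤y⇒0≤y-x βB.bound)) (inj₁ 0<D⁻¹)))
      ; tight⇒attained = tight⇒attained
      ; attained⇒tight = attained⇒tight
      }
      where
      tight⇒attained : β * s ≡ 1r → AttainedAtLeaf (node l r) b β
      tight⇒attained βs≡1 = from-factors (*-zero⇒⊎ (≡.trans (≡.sym 1-βs≡) (x≡1⇒1-x≡0 βs≡1)))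
        where
        from-left : AttainedAtLeaf l (bL a b) β → AttainedAtLeaf (node l r) b β
        from-left (i , i-leaf , bi≡β) = goL i , i-leaf , bi≡β
        from-right : AttainedAtLeaf r (bR a b) β → AttainedAtLeaf (node l r) b β
        from-right (i , i-leaf , bi≡β) = goR i , i-leaf , bi≡β
        from-factors : (1r - β * A) * (1r - v) ≡ 0r ⊎ D⁻¹ ≡ 0r → AttainedAtLeaf (node l r) b β
        from-factors (inj₂ D⁻¹≡0) = ⊥-elim (<⇒≢ 0<D⁻¹ (≡.sym D⁻¹≡0))
        from-factors (inj₁ product≡0) = [ from-left ∘ βA.tight⇒attained ∘ 1-x≡0⇒x≡1
                                        , from-right ∘ βB.tight⇒attained ∘ 1-x≡0⇒x≡1 ]′ (*-zero⇒⊎ product≡0)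
      attained⇒tight : AttainedAtLeaf (node l r) b β → β * s ≡ 1r
      attained⇒tight (goL i , i-leaf , bi≡β) = 1-x≡0⇒x≡1 (begin
        1r - β * s                        ≡⟨ 1-βs≡ ⟩
        ((1r - β * A) * (1r - v)) * D⁻¹   ≡⟨ cong (λ t → (t * (1r - v)) * D⁻¹)
                                                  (x≡1⇒1-x≡0 (βA.attained⇒tight (i , i-leaf , bi≡β))) ⟩
        (0r * (1r - v)) * D⁻¹             ≡⟨ ≡.trans (cong (_* D⁻¹) (zeroˡ _)) (zeroˡ D⁻¹) ⟩
        0r                                ∎)
      attained⇒tight (goR i , i-leaf , bi≡β) = 1-x≡0⇒x≡1 (begin
        1r - β * s                        ≡⟨ 1-βs≡ ⟩
        ((1r - β * A) * (1r - v)) * D⁻¹   ≡⟨ cong (λ t → ((1r - β * A) * t) * D⁻¹)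
                                                  (x≡1⇒1-x≡0 (βB.attained⇒tight (i , i-leaf , bi≡β))) ⟩
        ((1r - β * A) * 0r) * D⁻¹         ≡⟨ ≡.trans (cong (_* D⁻¹) (zeroʳ _)) (zeroˡ D⁻¹) ⟩
        0r                                ∎)

    potential : RootPotential false (node l r) a b
    potential = record
      { ν = ν ; unique = unique ; positive⇒avoids = positive⇒avoids ; avoids⇒positive = avoids⇒positive
      ; root-invariant = 0<s , βs-bound }

  module SpineNode {l r : Tree} {a b : Pos (node l r) → ℝ} (adm : Admissible true (node l r) a b)
                   (P₁ : RootPotential false l (aL a b) (bL a b))
                   (P₂ : RootPotential true r (aR a b) (bR a b)) where
    open Admissible adm
    module P₁ = RootPotential P₁
    module P₂ = RootPotential P₂
    open ≡.≡-Reasoning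

    α A : ℝ
    α = a here
    A = ∑[ leaves l ] P₁.ν

    αA-bound : LevelBound l (bL a b) α A
    αA-bound = MassBound-scale α P₁.root-invariant (λ i → b-mono (goL here) (goL i) (⪯-L ⪯-here))
                                (≤-trans (a-mono here (goL here) ⪯-here) (a≤b (goL here)))
    module αA = LevelBound αA-bound

    0<1-αA : 0r < 1r - α * A
    0<1-αA = x<y⇒0<y-x (≤∧≢⇒< αA.bound (no-tie ∘ αA.tight⇒attained))
      where
      no-tie : ¬ AttainedAtLeaf l (bL a b) α
      no-tie (i , i-leaf , bi≡α) = no-tie-on-spine here (goL here) (goL i) ⪯-here ch-L (⪯-L ⪯-here) i-leaf bi≡α

    lower-left≡last-column : ∀ i j → IsLeaf i → Ũ true (node l r) a b (goR i) (goL j) ≡ Ũ true r (aR a b) (bR a b) i (last r)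
    lower-left≡last-column i j i-leaf = ≡.trans (≡.sym (spine-eq (goR (meet i (last r))) (⪯-R (meet-⪯ʳ i (last r)))))
                                                (≡.sym (last-column r _ _ i i-leaf))

    ν : Pos (node l r) → ℝ
    ν = glue (λ _ → 0r) P₂.ν

    solution-goL : ∀ x c → IsSolutionᵗ true (node l r) a b x c →
                   IsSolutionᵗ false l (aL a b) (bL a b) (λ p → x (goL p)) (α * ∑[ leaves l ] (λ p → x (goL p)))
    solution-goL x c solution j j-leaf = ≡.trans (x+y≡z⇒x≡z-y (begin
      ∑[ leaves l ] (λ i → Ũ false l (aL a b) (bL a b) i j * x (goL i)) + (c - α * Sx)
        ≡⟨ cong₂ _+_ (∑-cong (leaves l) (λ i → cong (_* x (goL i)) (≡.sym (Ũ-goL a b true i j))))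
                     (≡.sym (≡.trans (∑-leaves-cong r (λ i i-leaf → cong (_* x (goR i)) (lower-left≡last-column i j i-leaf)))
                                     (solution-goR a b x c true solution (last r) (last-isLeaf r)))) ⟩
      ∑[ leaves l ] (λ i → Ũ true (node l r) a b (goL i) (goL j) * x (goL i))
        + ∑[ leaves r ] (λ i → Ũ true (node l r) a b (goR i) (goL j) * x (goR i))
        ≡⟨ ≡.sym (∑-node l r _) ⟩
      ∑[ leaves (node l r) ] (λ i → Ũ true (node l r) a b i (goL j) * x i)
        ≡⟨ solution (goL j) j-leaf ⟩
      c ∎)) (solve 3 (λ c α S → c :- (c :- α :* S) := α :* S) ≡.refl c α Sx)
      where
      Sx : ℝ
      Sx = ∑[ leaves l ] (λ p → x (goL p))

    unique : ∀ x c → IsSolutionᵗ true (node l r) a b x c → ∀ i → IsLeaf i → x i ≡ c * ν i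
    unique x c solution = x≡cν
      where
      Sx : ℝ
      Sx = ∑[ leaves l ] (λ p → x (goL p))
      x₁≡ : ∀ i → IsLeaf i → x (goL i) ≡ (α * Sx) * P₁.ν i
      x₁≡ = P₁.unique _ (α * Sx) (solution-goL x c solution)
      Sx≡0 : Sx ≡ 0r
      Sx≡0 = *-cancelʳ-zero 0<1-αA (begin
        Sx * (1r - α * A)             ≡⟨ solve 3 (λ S α A → S :* (con 1ℤ :- α :* A) := S :- (α :* S) :* A) ≡.refl Sx α A ⟩
        Sx - (α * Sx) * A             ≡⟨ x≡y⇒x-y≡0 (≡.trans (∑-leaves-cong l x₁≡) (∑-*ˡ (α * Sx) P₁.ν (leaves l))) ⟩
        0r                            ∎)
      x≡cν : ∀ i → IsLeaf i → x i ≡ c * ν i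
      x≡cν (goL i) i-leaf = begin
        x (goL i)                     ≡⟨ x₁≡ i i-leaf ⟩
        (α * Sx) * P₁.ν i             ≡⟨ cong (λ t → (α * t) * P₁.ν i) Sx≡0 ⟩
        (α * 0r) * P₁.ν i             ≡⟨ solve 3 (λ α ν c → (α :* con (ℤ.+ 0)) :* ν := c :* con (ℤ.+ 0))
                                                 ≡.refl α (P₁.ν i) c ⟩
        c * 0r                        ∎
      x≡cν (goR i) i-leaf = begin
        x (goR i)                     ≡⟨ P₂.unique _ _ (solution-goR a b x c true solution) i i-leaf ⟩
        (c - α * Sx) * P₂.ν i         ≡⟨ cong (λ t → (c - α * t) * P₂.ν i) Sx≡0 ⟩
        (c - α * 0r) * P₂.ν i         ≡⟨ cong (_* P₂.ν i) (solve 2 (λ c α → c :- α :* con (ℤ.+ 0) := c) ≡.refl c α) ⟩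
        c * P₂.ν i                    ∎

    positive⇒avoids : ∀ i → IsLeaf i → 0r < ν i → Avoids true (node l r) a b i here
    positive⇒avoids (goL i) _ 0<0 = ⊥-elim (<-irrefl 0<0)
    positive⇒avoids (goR i) i-leaf 0<νi =
      Avoids-root-goR⇐ i (λ root-edge → proj₁ root-edge ⪯-here) (P₂.positive⇒avoids i i-leaf 0<νi)

    avoids⇒positive : ∀ i → IsLeaf i → Avoids true (node l r) a b i here → 0r < ν i
    avoids⇒positive (goL i) _ avoids = ⊥-elim (proj₁ (Avoids-root-goL⇒ i avoids) (inj₁ ⪯-here))
    avoids⇒positive (goR i) i-leaf avoids = P₂.avoids⇒positive i i-leaf (proj₂ (Avoids-root-goR⇒ i avoids))

    positive-only-at-last : RootInvariant true (node l r) b ν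
    positive-only-at-last (goL i) _ = (λ 0<0 → ⊥-elim (<-irrefl 0<0)) , (λ ())
    positive-only-at-last (goR i) i-leaf =
      let positive⇒last , last⇒positive = P₂.root-invariant i i-leaf
      in cong goR ∘ positive⇒last , last⇒positive ∘ goR-injective

    potential : RootPotential true (node l r) a b
    potential = record
      { ν = ν ; unique = unique ; positive⇒avoids = positive⇒avoids ; avoids⇒positive = avoids⇒positive
      ; root-invariant = positive-only-at-last }

  root-potential : ∀ sp S a b → Admissible sp S a b → RootPotential sp S a b
  root-potential sp leaf a b adm = leaf-potential sp a b adm
  root-potential false (node l r) a b adm =
    OffSpineNode.potential adm (root-potential false l _ _ (Admissible-goL adm)) (root-potential false r _ _ (Admissible-goR adm))
  root-potential true (node l r) a b adm =
    SpineNode.potential adm (root-potential false l _ _ (Admissible-goL adm)) (root-potential true r _ _ (Admissible-goR adm))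

  potential≡root-potential : ∀ sp S a b (adm : Admissible sp S a b) ν → IsPotential sp S a b here ν →
                             ∀ i → IsLeaf i → ν i ≡ RootPotential.ν (root-potential sp S a b adm) i
  potential≡root-potential sp S a b adm ν pot i i-leaf =
    ≡.trans (RootPotential.unique (root-potential sp S a b adm) ν 1r (potential-root sp S a b ν pot) i i-leaf) (*-identityˡ _)

  positive⇔last : ∀ S a b → Admissible true S a b → ∀ ν → IsPotential true S a b here ν →
                  ∀ i → IsLeaf i → (0r < ν i → i ≡ last S) × (i ≡ last S → 0r < ν i)
  positive⇔last S a b adm ν pot i i-leaf =
    let positive⇒last , last⇒positive = RootPotential.root-invariant (root-potential true S a b adm) i i-leaf
    in positive⇒last ∘ subst (0r <_) ν≡ , subst (0r <_) (≡.sym ν≡) ∘ last⇒positive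
    where
    ν≡ : ν i ≡ RootPotential.ν (root-potential true S a b adm) i
    ν≡ = potential≡root-potential true S a b adm ν pot i i-leaf

  positive⇔avoids : ∀ sp S a b → Admissible sp S a b → ∀ L ν → IsPotential sp S a b L ν →
                    ∀ i → IsLeaf i → L ⪯ i → (0r < ν i → Avoids sp S a b i L) × (Avoids sp S a b i L → 0r < ν i)
  positive⇔avoids sp S a b adm here ν pot i i-leaf _ =
    (positive⇒avoids i i-leaf ∘ subst (0r <_) ν≡) , (subst (0r <_) (≡.sym ν≡) ∘ avoids⇒positive i i-leaf)
    where
    open RootPotential (root-potential sp S a b adm) using (positive⇒avoids; avoids⇒positive)
    ν≡ : ν i ≡ RootPotential.ν (root-potential sp S a b adm) i
    ν≡ = potential≡root-potential sp S a b adm ν pot i i-leaf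
  positive⇔avoids sp (node l r) a b adm (goL L) ν pot (goL i) i-leaf (⪯-L L⪯i) =
    let positive⇒avoids , avoids⇒positive = positive⇔avoids false l _ _ (Admissible-goL adm) L _ (IsPotential-goL L ν pot) i i-leaf L⪯i
    in Avoids-goL⇐ i L ∘ positive⇒avoids , avoids⇒positive ∘ Avoids-goL⇒ i L
  positive⇔avoids sp (node l r) a b adm (goR L) ν pot (goR i) i-leaf (⪯-R L⪯i) =
    let positive⇒avoids , avoids⇒positive = positive⇔avoids sp r _ _ (Admissible-goR adm) L _ (IsPotential-goR L ν pot) i i-leaf L⪯i
    in Avoids-goR⇐ i L ∘ positive⇒avoids , avoids⇒positive ∘ Avoids-goR⇒ i L

theorem3p1 : (F : RealField) (T : Tree) (α β : Pos T → RealField.ℝ F) →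
    IsUData F T α β →
    Nonsingular F T (Umat F T α β) →
    ((ν : Pos T → RealField.ℝ F) → IsPotentialᵗ F T (Umat F T α β) here ν →
      ∀ i → IsLeaf i →
        (ExitingRootᵗ F ν i → i ≡ last T) × (i ≡ last T → ExitingRootᵗ F ν i))
    ×
    ((L : Pos T) (ν : Pos T → RealField.ℝ F) → IsPotentialᵗ F T (Umat F T α β) L ν →
      ∀ i → IsLeaf i → L ⪯ i →
        (ExitingRootᵗ F ν i → GeodAvoidsΓᵗ F T α β i L)
        × (GeodAvoidsΓᵗ F T α β i L → ExitingRootᵗ F ν i))
theorem3p1 F T α β U-data U-nonsingular = exiting-root-is-last , exiting-root⇔geod-avoids-Γ
  where
  open OrderedField F
  open LocalMatrix F
  open Recursion F

  admissible : Admissible true T α β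
  admissible = NonDegeneracy.admissible F T α β U-data U-nonsingular

  exiting-root-is-last : ∀ ν → IsPotentialᵗ F T (Umat F T α β) here ν → ∀ i → IsLeaf i →
                         (0r < ν i → i ≡ last T) × (i ≡ last T → 0r < ν i)
  exiting-root-is-last ν pot = positive⇔last T α β admissible ν (Umat-potential⇒IsPotential pot)

  exiting-root⇔geod-avoids-Γ : ∀ L ν → IsPotentialᵗ F T (Umat F T α β) L ν → ∀ i → IsLeaf i → L ⪯ i →
                               (0r < ν i → GeodAvoidsΓᵗ F T α β i L) × (GeodAvoidsΓᵗ F T α β i L → 0r < ν i)
  exiting-root⇔geod-avoids-Γ L ν pot i i-leaf L⪯i =
    let positive⇒avoids , avoids⇒positive =
          positive⇔avoids true T α β admissible L ν (Umat-potential⇒IsPotential pot) i i-leaf L⪯i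
    in Avoids⇒GeodAvoidsΓᵗ ∘ positive⇒avoids , avoids⇒positive ∘ GeodAvoidsΓᵗ⇒Avoids
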